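{- Let $s,k,n$ be integers and $m\ge 1$. Let $p,q,r,a,b,c$ be real numbers with $c\neq 0$, let $(P_n)_{n\in\mathbb{Z}}=\mathcal{P}(x)(p,q,r;a,b,c)$, $(U_n)_{n\in\mathbb{Z}}=\mathcal{P}(x)(0,0,1;a,b,c)$, and $\Delta_{\mathcal{P}}=(q^2-apq)x^2+(2qr-apr-bpq)x+(r^2-bpr-cp^2)$. Then \[ \det\Big(\Big[\frac{1}{P_{s+k(n+i+j)}}\Big]_{0\le i,j\le m}\Big) = \frac{(-1)^{(s+kn)\binom{m+1}{2}}\,c^{(s+kn)\binom{m+1}{2}+2k\binom{m+1}{3}}\,\Delta_{\mathcal{P}}^{\binom{m+1}{2}}\prod_{i=0}^m U_{k(i+1)}^{2(m-i)}}{\prod_{0\le i,j\le m}P_{s+k(n+i+j)}}, \] provided that the denominators on both sides of the identity are nonzero.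
   Context: For real numbers $p,q,r,a,b,c$ with $c\neq 0$, $\mathcal{P}(x)(p,q,r;a,b,c)=(P_n)_{n\in\mathbb{Z}}$ denotes the sequence of polynomials in $x$ defined by $P_0=p$, $P_1=qx+r$, $P_{n+2}=(ax+b)P_{n+1}+cP_n$ for $n\ge 0$, and for $n<0$ by $P_n=-\frac{ax+b}{c}P_{n+1}+\frac{1}{c}P_{n+2}$; so $U_0=0$, $U_1=1$. $[M_{i,j}]_{0\le i,j\le m}$ is the $(m+1)\times(m+1)$ matrix with entry $M_{i,j}$ in row $i$, column $j$. -}

module Defs where

open import Level using (0ℓ)
open import Data.Nat as ℕ using (ℕ; zero; suc)
open import Data.Nat.Combinatorics using (_C_)
open import Data.Integer as ℤ using (ℤ; +_; -[1+_])
open import Data.Fin using (Fin; zero; suc; punchIn)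
open import Data.Product using (Σ; ∃; _×_; _,_; proj₁; proj₂)
open import Data.Sum using (_⊎_)
open import Relation.Binary.PropositionalEquality using (_≡_)
open import Relation.Binary.Structures using (IsStrictTotalOrder)
open import Algebra.Structures using (IsCommutativeRing)
open import Relation.Nullary using (¬_)

-- A model of the real numbers: a Dedekind-complete ordered field
-- (unique up to isomorphism), with equality taken to be _≡_.
-- The inverse is total; x⁻¹ is only constrained for x ≢ 0#.
record RealField : Set₁ where
  infixl 6 _+_ _-_
  infixl 7 _*_
  infix 8 -_
  infix 4 _<_ _≤_
  field
    Carrier : Set
    _+_ _*_ : Carrier → Carrier → Carrier
    -_ : Carrier → Carrier
    0# 1# : Carrier
    _⁻¹ : Carrier → Carrier
    _<_ : Carrier → Carrier → Set
    isCommutativeRing : IsCommutativeRing _≡_ _+_ _*_ -_ 0# 1#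
    0≢1 : ¬ (0# ≡ 1#)
    inverseʳ : ∀ x → ¬ (x ≡ 0#) → x * (x ⁻¹) ≡ 1#
    isStrictTotalOrder : IsStrictTotalOrder _≡_ _<_
    +-mono-< : ∀ x y z → x < y → x + z < y + z
    *-pos : ∀ x y → 0# < x → 0# < y → 0# < x * y

  _-_ : Carrier → Carrier → Carrier
  x - y = x + (- y)

  _≤_ : Carrier → Carrier → Set
  x ≤ y = (x < y) ⊎ (x ≡ y)

  field
    complete : (S : Carrier → Set) → (∃ λ y → S y) →
               (∃ λ u → ∀ y → S y → y ≤ u) →
               ∃ λ s → (∀ y → S y → y ≤ s) ×
                        (∀ u → (∀ y → S y → y ≤ u) → s ≤ u)

module _ (ℝ : RealField) where
  open RealField ℝ

  _^_ : Carrier → ℕ → Carrier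
  x ^ zero = 1#
  x ^ suc n = x * (x ^ n)

  _^ᶻ_ : Carrier → ℤ → Carrier
  x ^ᶻ (+ n) = x ^ n
  x ^ᶻ -[1+ n ] = (x ^ suc n) ⁻¹

  Σ' : ∀ n → (Fin n → Carrier) → Carrier
  Σ' zero f = 0#
  Σ' (suc n) f = f zero + Σ' n (λ i → f (suc i))

  Π' : ∀ n → (Fin n → Carrier) → Carrier
  Π' zero f = 1#
  Π' (suc n) f = f zero * Π' n (λ i → f (suc i))

  sgn : ∀ {n} → Fin n → Carrier
  sgn zero = 1#
  sgn (suc j) = - sgn j

  det : ∀ n → (Fin n → Fin n → Carrier) → Carrier
  det zero M = 1#
  det (suc n) M =
    Σ' (suc n) (λ j → sgn j * M zero j * det n (λ i l → M (suc i) (punchIn j l)))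

  -- The sequence 𝒫(x)(p,q,r;a,b,c) evaluated at x, indexed by ℤ.
  module Seq (x p q r a b c : Carrier) where
    posPair : ℕ → Carrier × Carrier
    posPair zero = p , q * x + r
    posPair (suc n) with posPair n
    ... | (u , v) = v , (a * x + b) * v + c * u

    -- (P_{-n} , P_{-n+1}) for n ≥ 0, using P_n = -((ax+b)/c) P_{n+1} + (1/c) P_{n+2}
    negPair : ℕ → Carrier × Carrier
    negPair zero = p , q * x + r
    negPair (suc n) with negPair n
    ... | (u , v) = (- ((a * x + b) * (c ⁻¹)) * u + (c ⁻¹) * v) , u

    P : ℤ → Carrier
    P (+ n) = proj₁ (posPair n)
    P -[1+ n ] = proj₁ (negPair (suc n))

  𝒫 : (x p q r a b c : Carrier) → ℤ → Carrier
  𝒫 x p q r a b c = Seq.P x p q r a b c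

-- By the addition formula P (t + w) = P (t + 1) U w + c P t U (w − 1), the entries P (u + k i + k j)
-- form a rank-two matrix a i * g j + b i * h j. For such a matrix, eliminating the first column of the
-- entrywise inverse reproduces a matrix of the same kind, so by induction
--   det (1 / (a i g j + b i h j)) · ∏ (a i g j + b i h j) = ∏_{i<j} (a j b i − a i b j) (h j g i − h i g j).
-- Each of these 2 × 2 minors is a d'Ocagne identity
--   P t P (t + w + 1) − P (t + 1) P (t + w) = − (− c) ^ t Δ U w,
-- and collecting the powers of − c, Δ and U (k (i + 1)) gives the closed form.
module Submission where

open import Defs
open import Function using (_∘_)
open import Data.Nat as ℕ using (ℕ; zero; suc; _∸_)
open import Data.Nat.Combinatorics using (_C_; nC1≡n; nCk+nC[k+1]≡[n+1]C[k+1])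
import Data.Nat.Properties as ℕP
open import Data.Integer as ℤ using (ℤ; -[1+_])
import Data.Integer.Properties as ℤP
open import Data.Integer.Solver using (module +-*-Solver)
open import Data.Fin as F using (Fin; zero; suc; punchIn; toℕ)
import Data.Fin.Properties as FP
open import Data.Maybe using (Maybe; just; nothing)
open import Data.Product using (_×_; _,_; proj₁; proj₂)
open import Data.Empty using (⊥-elim)
open import Relation.Binary.PropositionalEquality
open import Relation.Nullary using (¬_; Dec; yes; no)
open import Algebra.Bundles using (CommutativeRing)
open import Algebra.Structures using (IsCommutativeRing)
import Algebra.Solver.Ring.AlmostCommutativeRing as ACR

open +-*-Solver using () renaming (solve to solveℤ; _:+_ to _:+ᶻ_; _:*_ to _:*ᶻ_; _:=_ to _:=ᶻ_; con to conᶻ)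

n+nC2≡[1+n]C2 : ∀ n → n ℕ.+ n C 2 ≡ suc n C 2
n+nC2≡[1+n]C2 n = trans (cong (ℕ._+ n C 2) (sym (nC1≡n n))) (nCk+nC[k+1]≡[n+1]C[k+1] n 1)

ℤ+-suc : ∀ i j → i ℤ.+ ℤ.suc j ≡ ℤ.suc (i ℤ.+ j)
ℤ+-suc = solveℤ 2 (λ i j → i :+ᶻ (conᶻ (ℤ.+ 1) :+ᶻ j) :=ᶻ conᶻ (ℤ.+ 1) :+ᶻ (i :+ᶻ j)) refl

module FieldProperties (ℝ : RealField) where
  open RealField ℝ public
  open IsCommutativeRing isCommutativeRing public
    using ( +-assoc; +-comm; +-identityˡ; +-identityʳ; -‿inverseʳ
          ; *-assoc; *-comm; *-identityˡ; *-identityʳ; distribˡ; distribʳ; zeroˡ; zeroʳ)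

  commutativeRing : CommutativeRing _ _
  commutativeRing = record { isCommutativeRing = isCommutativeRing }

  open CommutativeRing commutativeRing using (ring; +-abelianGroup)
  open import Algebra.Properties.Ring ring public
    using (-‿distribˡ-*; -‿distribʳ-*; -0#≈0#; -‿involutive)
  open import Algebra.Properties.AbelianGroup +-abelianGroup using (⁻¹-∙-comm)
  open ≡-Reasoning

  -- 1 goes to 1# definitionally, so that the solver constants 𝟘 and 𝟙 evaluate to 0# and 1# on the nose.
  fromℕ : ℕ → Carrier
  fromℕ zero = 0#
  fromℕ (suc zero) = 1#
  fromℕ (suc (suc n)) = 1# + fromℕ (suc n)

  fromℤ : ℤ → Carrier
  fromℤ (ℤ.+ n) = fromℕ n
  fromℤ -[1+ n ] = - fromℕ (suc n)

  fromℕ-suc : ∀ n → fromℕ (suc n) ≡ 1# + fromℕ n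
  fromℕ-suc zero = sym (+-identityʳ 1#)
  fromℕ-suc (suc n) = refl

  fromℕ-+ : ∀ m n → fromℕ (m ℕ.+ n) ≡ fromℕ m + fromℕ n
  fromℕ-+ zero n = sym (+-identityˡ _)
  fromℕ-+ (suc m) n = begin
    fromℕ (suc (m ℕ.+ n))        ≡⟨ fromℕ-suc (m ℕ.+ n) ⟩
    1# + fromℕ (m ℕ.+ n)         ≡⟨ cong (1# +_) (fromℕ-+ m n) ⟩
    1# + (fromℕ m + fromℕ n)     ≡⟨ sym (+-assoc _ _ _) ⟩
    (1# + fromℕ m) + fromℕ n     ≡⟨ cong (_+ fromℕ n) (sym (fromℕ-suc m)) ⟩
    fromℕ (suc m) + fromℕ n      ∎

  fromℕ-* : ∀ m n → fromℕ (m ℕ.* n) ≡ fromℕ m * fromℕ n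
  fromℕ-* zero n = sym (zeroˡ _)
  fromℕ-* (suc m) n = begin
    fromℕ (n ℕ.+ m ℕ.* n)          ≡⟨ fromℕ-+ n (m ℕ.* n) ⟩
    fromℕ n + fromℕ (m ℕ.* n)      ≡⟨ cong₂ _+_ (sym (*-identityˡ _)) (fromℕ-* m n) ⟩
    1# * fromℕ n + fromℕ m * fromℕ n ≡⟨ sym (distribʳ _ _ _) ⟩
    (1# + fromℕ m) * fromℕ n       ≡⟨ cong (_* fromℕ n) (sym (fromℕ-suc m)) ⟩
    fromℕ (suc m) * fromℕ n        ∎

  +-cancel-- : ∀ x y z → (x + y) - (x + z) ≡ y - z
  +-cancel-- x y z = begin
    (x + y) + - (x + z)     ≡⟨ cong ((x + y) +_) (sym (⁻¹-∙-comm x z)) ⟩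
    (x + y) + (- x + - z)   ≡⟨ +-assoc x y _ ⟩
    x + (y + (- x + - z))   ≡⟨ cong (x +_) (sym (+-assoc y _ _)) ⟩
    x + ((y + - x) + - z)   ≡⟨ cong (λ t → x + (t + - z)) (+-comm y _) ⟩
    x + ((- x + y) + - z)   ≡⟨ cong (x +_) (+-assoc _ _ _) ⟩
    x + (- x + (y + - z))   ≡⟨ sym (+-assoc _ _ _) ⟩
    (x + - x) + (y + - z)   ≡⟨ cong (_+ (y - z)) (-‿inverseʳ x) ⟩
    0# + (y - z)            ≡⟨ +-identityˡ _ ⟩
    y - z                   ∎

  fromℤ-⊖ : ∀ m n → fromℤ (m ℤ.⊖ n) ≡ fromℕ m - fromℕ n
  fromℤ-⊖ zero zero = sym (trans (+-identityˡ _) -0#≈0#)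
  fromℤ-⊖ (suc m) zero = sym (trans (cong (fromℕ (suc m) +_) -0#≈0#) (+-identityʳ _))
  fromℤ-⊖ zero (suc n) = sym (+-identityˡ _)
  fromℤ-⊖ (suc m) (suc n) = begin
    fromℤ (suc m ℤ.⊖ suc n)  ≡⟨ cong fromℤ (ℤP.[1+m]⊖[1+n]≡m⊖n m n) ⟩
    fromℤ (m ℤ.⊖ n)          ≡⟨ fromℤ-⊖ m n ⟩
    fromℕ m - fromℕ n        ≡⟨ sym (+-cancel-- 1# (fromℕ m) (fromℕ n)) ⟩
    (1# + fromℕ m) - (1# + fromℕ n) ≡⟨ sym (cong₂ _-_ (fromℕ-suc m) (fromℕ-suc n)) ⟩
    fromℕ (suc m) - fromℕ (suc n) ∎

  fromℤ-neg : ∀ i → fromℤ (ℤ.- i) ≡ - fromℤ i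
  fromℤ-neg (ℤ.+ zero) = sym -0#≈0#
  fromℤ-neg (ℤ.+ suc n) = refl
  fromℤ-neg -[1+ n ] = sym (-‿involutive _)

  fromℤ-+ : ∀ i j → fromℤ (i ℤ.+ j) ≡ fromℤ i + fromℤ j
  fromℤ-+ (ℤ.+ m) (ℤ.+ n) = fromℕ-+ m n
  fromℤ-+ (ℤ.+ m) -[1+ n ] = fromℤ-⊖ m (suc n)
  fromℤ-+ -[1+ m ] (ℤ.+ n) = trans (fromℤ-⊖ n (suc m)) (+-comm _ _)
  fromℤ-+ -[1+ m ] -[1+ n ] = begin
    - fromℕ (suc (suc m) ℕ.+ n)      ≡⟨ cong -_ (fromℕ-+ (suc (suc m)) n) ⟩
    - ((1# + fromℕ (suc m)) + fromℕ n) ≡⟨ cong (λ t → - (t + fromℕ n)) (+-comm 1# _) ⟩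
    - ((fromℕ (suc m) + 1#) + fromℕ n) ≡⟨ cong -_ (+-assoc _ _ _) ⟩
    - (fromℕ (suc m) + (1# + fromℕ n)) ≡⟨ cong (λ t → - (fromℕ (suc m) + t)) (sym (fromℕ-suc n)) ⟩
    - (fromℕ (suc m) + fromℕ (suc n))  ≡⟨ sym (⁻¹-∙-comm _ _) ⟩
    - fromℕ (suc m) + - fromℕ (suc n)  ∎

  fromℤ-*⁺ : ∀ m j → fromℤ (ℤ.+ m ℤ.* j) ≡ fromℕ m * fromℤ j
  fromℤ-*⁺ m (ℤ.+ n) = trans (cong fromℤ (sym (ℤP.pos-* m n))) (fromℕ-* m n)
  fromℤ-*⁺ m -[1+ n ] = begin
    fromℤ (ℤ.+ m ℤ.* -[1+ n ])          ≡⟨ cong fromℤ (sym (ℤP.neg-distribʳ-* (ℤ.+ m) (ℤ.+ suc n))) ⟩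
    fromℤ (ℤ.- (ℤ.+ m ℤ.* ℤ.+ suc n))     ≡⟨ fromℤ-neg (ℤ.+ m ℤ.* ℤ.+ suc n) ⟩
    - fromℤ (ℤ.+ m ℤ.* ℤ.+ suc n)         ≡⟨ cong -_ (fromℤ-*⁺ m (ℤ.+ suc n)) ⟩
    - (fromℕ m * fromℕ (suc n))       ≡⟨ -‿distribʳ-* _ _ ⟩
    fromℕ m * - fromℕ (suc n)         ∎

  fromℤ-* : ∀ i j → fromℤ (i ℤ.* j) ≡ fromℤ i * fromℤ j
  fromℤ-* (ℤ.+ m) j = fromℤ-*⁺ m j
  fromℤ-* -[1+ m ] j = begin
    fromℤ (-[1+ m ] ℤ.* j)            ≡⟨ cong fromℤ (sym (ℤP.neg-distribˡ-* (ℤ.+ suc m) j)) ⟩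
    fromℤ (ℤ.- (ℤ.+ suc m ℤ.* j))       ≡⟨ fromℤ-neg (ℤ.+ suc m ℤ.* j) ⟩
    - fromℤ (ℤ.+ suc m ℤ.* j)           ≡⟨ cong -_ (fromℤ-*⁺ (suc m) j) ⟩
    - (fromℕ (suc m) * fromℤ j)       ≡⟨ -‿distribˡ-* _ _ ⟩
    - fromℕ (suc m) * fromℤ j         ∎

  fromℤ-morphism : ACR._-Raw-AlmostCommutative⟶_
    (CommutativeRing.rawRing ℤP.+-*-commutativeRing) (ACR.fromCommutativeRing commutativeRing)
  fromℤ-morphism = record
    { ⟦_⟧ = fromℤ ; +-homo = fromℤ-+ ; *-homo = fromℤ-* ; -‿homo = fromℤ-neg
    ; 0-homo = refl ; 1-homo = refl }

  fromℤ-≟ : ∀ i j → Maybe (fromℤ i ≡ fromℤ j)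
  fromℤ-≟ i j with i ℤ.≟ j
  ... | yes i≡j = just (cong fromℤ i≡j)
  ... | no _ = nothing

  open import Algebra.Solver.Ring (CommutativeRing.rawRing ℤP.+-*-commutativeRing)
    (ACR.fromCommutativeRing commutativeRing) fromℤ-morphism fromℤ-≟ public

  𝟘 𝟙 -𝟙 : ∀ {n} → Polynomial n
  𝟘 = con (ℤ.+ 0)
  𝟙 = con (ℤ.+ 1)
  -𝟙 = con -[1+ 0 ]

  NonZero : Carrier → Set
  NonZero x = ¬ (x ≡ 0#)

  1≢0 : NonZero 1#
  1≢0 1≡0 = 0≢1 (sym 1≡0)

  -x≡0⇒x≡0 : ∀ {x} → - x ≡ 0# → x ≡ 0#
  -x≡0⇒x≡0 {x} -x≡0 = trans (sym (-‿involutive x)) (trans (cong -_ -x≡0) -0#≈0#)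

  -‿nonZero : ∀ {x} → NonZero x → NonZero (- x)
  -‿nonZero x≢0 = x≢0 ∘ -x≡0⇒x≡0

  -1≢0 : NonZero (- 1#)
  -1≢0 = -‿nonZero 1≢0

  inverseˡ : ∀ x → NonZero x → x ⁻¹ * x ≡ 1#
  inverseˡ x x≢0 = trans (*-comm _ _) (inverseʳ x x≢0)

  *-cancelˡ : ∀ {x y z} → NonZero x → x * y ≡ x * z → y ≡ z
  *-cancelˡ {x} {y} {z} x≢0 xy≡xz = begin
    y                ≡⟨ sym (*-identityˡ y) ⟩
    1# * y           ≡⟨ cong (_* y) (sym (inverseˡ x x≢0)) ⟩
    (x ⁻¹ * x) * y   ≡⟨ *-assoc _ _ _ ⟩
    x ⁻¹ * (x * y)   ≡⟨ cong (x ⁻¹ *_) xy≡xz ⟩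
    x ⁻¹ * (x * z)   ≡⟨ sym (*-assoc _ _ _) ⟩
    (x ⁻¹ * x) * z   ≡⟨ cong (_* z) (inverseˡ x x≢0) ⟩
    1# * z           ≡⟨ *-identityˡ z ⟩
    z                ∎

  *-nonZero : ∀ {x y} → NonZero x → NonZero y → NonZero (x * y)
  *-nonZero {x} x≢0 y≢0 xy≡0 = y≢0 (*-cancelˡ x≢0 (trans xy≡0 (sym (zeroʳ x))))

  ⁻¹-unique : ∀ {x y} → NonZero x → x * y ≡ 1# → y ≡ x ⁻¹
  ⁻¹-unique {x} x≢0 xy≡1 = *-cancelˡ x≢0 (trans xy≡1 (sym (inverseʳ x x≢0)))

  ⁻¹-distrib-* : ∀ {x y} → NonZero x → NonZero y → (x * y) ⁻¹ ≡ x ⁻¹ * y ⁻¹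
  ⁻¹-distrib-* {x} {y} x≢0 y≢0 = sym (⁻¹-unique (*-nonZero x≢0 y≢0) (begin
    (x * y) * (x ⁻¹ * y ⁻¹)    ≡⟨ solve 4 (λ x y x′ y′ → (x :* y) :* (x′ :* y′) := (x :* x′) :* (y :* y′)) refl
                                    x y (x ⁻¹) (y ⁻¹) ⟩
    (x * x ⁻¹) * (y * y ⁻¹)    ≡⟨ cong₂ _*_ (inverseʳ x x≢0) (inverseʳ y y≢0) ⟩
    1# * 1#                    ≡⟨ *-identityˡ 1# ⟩
    1#                         ∎))

  x+y≡0⇒x≡-y : ∀ {x y} → x + y ≡ 0# → x ≡ - y
  x+y≡0⇒x≡-y {x} {y} x+y≡0 = begin
    x               ≡⟨ solve 2 (λ x y → x := (x :+ y) :+ :- y) refl x y ⟩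
    (x + y) + - y   ≡⟨ cong (_+ - y) x+y≡0 ⟩
    0# + - y        ≡⟨ +-identityˡ _ ⟩
    - y             ∎

  x*y⁻¹*y≡x : ∀ x {y} → NonZero y → x * y ⁻¹ * y ≡ x
  x*y⁻¹*y≡x x {y} y≢0 = trans (*-assoc _ _ _) (trans (cong (x *_) (inverseˡ y y≢0)) (*-identityʳ x))

  x*y*y⁻¹≡x : ∀ x {y} → NonZero y → x * y * y ⁻¹ ≡ x
  x*y*y⁻¹≡x x {y} y≢0 = trans (*-assoc _ _ _) (trans (cong (x *_) (inverseʳ y y≢0)) (*-identityʳ x))

  x*[x*y]⁻¹≡y⁻¹ : ∀ {x y} → NonZero x → NonZero y → x * (x * y) ⁻¹ ≡ y ⁻¹
  x*[x*y]⁻¹≡y⁻¹ {x} {y} x≢0 y≢0 = begin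
    x * (x * y) ⁻¹        ≡⟨ cong (x *_) (⁻¹-distrib-* x≢0 y≢0) ⟩
    x * (x ⁻¹ * y ⁻¹)     ≡⟨ sym (*-assoc _ _ _) ⟩
    (x * x ⁻¹) * y ⁻¹     ≡⟨ cong (_* y ⁻¹) (inverseʳ x x≢0) ⟩
    1# * y ⁻¹             ≡⟨ *-identityˡ _ ⟩
    y ⁻¹                  ∎

  1⁻¹≡1 : 1# ⁻¹ ≡ 1#
  1⁻¹≡1 = sym (⁻¹-unique 1≢0 (*-identityˡ 1#))


module BigOperators (ℝ : RealField) where
  open FieldProperties ℝ
  open ≡-Reasoning

  ∑ : ∀ n → (Fin n → Carrier) → Carrier
  ∑ = Σ' ℝ

  ∏ : ∀ n → (Fin n → Carrier) → Carrier
  ∏ = Π' ℝ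

  ∑-cong : ∀ n {f g : Fin n → Carrier} → (∀ i → f i ≡ g i) → ∑ n f ≡ ∑ n g
  ∑-cong zero f≗g = refl
  ∑-cong (suc n) f≗g = cong₂ _+_ (f≗g zero) (∑-cong n (f≗g ∘ suc))

  ∑-+ : ∀ n (f g : Fin n → Carrier) → ∑ n (λ i → f i + g i) ≡ ∑ n f + ∑ n g
  ∑-+ zero f g = sym (+-identityˡ 0#)
  ∑-+ (suc n) f g = trans (cong ((f zero + g zero) +_) (∑-+ n (f ∘ suc) (g ∘ suc)))
    (solve 4 (λ a b c d → (a :+ b) :+ (c :+ d) := (a :+ c) :+ (b :+ d)) refl _ _ _ _)

  ∑-*ˡ : ∀ n x (f : Fin n → Carrier) → ∑ n (λ i → x * f i) ≡ x * ∑ n f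
  ∑-*ˡ zero x f = sym (zeroʳ x)
  ∑-*ˡ (suc n) x f = trans (cong ((x * f zero) +_) (∑-*ˡ n x (f ∘ suc))) (sym (distribˡ x _ _))

  ∑-linear : ∀ n {f g h : Fin n → Carrier} x y → (∀ i → f i ≡ x * g i + y * h i) →
    ∑ n f ≡ x * ∑ n g + y * ∑ n h
  ∑-linear n {f} {g} {h} x y f≗xg+yh = begin
    ∑ n f                                       ≡⟨ ∑-cong n f≗xg+yh ⟩
    ∑ n (λ i → x * g i + y * h i)               ≡⟨ ∑-+ n (λ i → x * g i) (λ i → y * h i) ⟩
    ∑ n (λ i → x * g i) + ∑ n (λ i → y * h i)   ≡⟨ cong₂ _+_ (∑-*ˡ n x g) (∑-*ˡ n y h) ⟩
    x * ∑ n g + y * ∑ n h                       ∎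

  ∑-zero : ∀ n {f : Fin n → Carrier} → (∀ i → f i ≡ 0#) → ∑ n f ≡ 0#
  ∑-zero zero f≗0 = refl
  ∑-zero (suc n) f≗0 = trans (cong₂ _+_ (f≗0 zero) (∑-zero n (f≗0 ∘ suc))) (+-identityˡ 0#)

  ∏-cong : ∀ n {f g : Fin n → Carrier} → (∀ i → f i ≡ g i) → ∏ n f ≡ ∏ n g
  ∏-cong zero f≗g = refl
  ∏-cong (suc n) f≗g = cong₂ _*_ (f≗g zero) (∏-cong n (f≗g ∘ suc))

  ∏-* : ∀ n (f g : Fin n → Carrier) → ∏ n (λ i → f i * g i) ≡ ∏ n f * ∏ n g
  ∏-* zero f g = sym (*-identityˡ 1#)
  ∏-* (suc n) f g = trans (cong ((f zero * g zero) *_) (∏-* n (f ∘ suc) (g ∘ suc)))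
    (solve 4 (λ a b c d → (a :* b) :* (c :* d) := (a :* c) :* (b :* d)) refl _ _ _ _)

  ∏-punchIn : ∀ n (f : Fin (suc n) → Carrier) j → ∏ (suc n) f ≡ f j * ∏ n (f ∘ punchIn j)
  ∏-punchIn n f zero = refl
  ∏-punchIn (suc n) f (suc j) = trans (cong (f zero *_) (∏-punchIn n (f ∘ suc) j))
    (solve 3 (λ a b c → a :* (b :* c) := b :* (a :* c)) refl _ _ _)

  ∏-last : ∀ n (f : Fin (suc n) → Carrier) → ∏ (suc n) f ≡ ∏ n (f ∘ F.inject₁) * f (F.fromℕ n)
  ∏-last zero f = *-comm _ _
  ∏-last (suc n) f = trans (cong (f zero *_) (∏-last n (f ∘ suc))) (sym (*-assoc _ _ _))

  ∏-const : ∀ n x → ∏ n (λ _ → x) ≡ _^_ ℝ x n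
  ∏-const zero x = refl
  ∏-const (suc n) x = cong (x *_) (∏-const n x)

  ∏-nonZero : ∀ n (f : Fin n → Carrier) → (∀ i → NonZero (f i)) → NonZero (∏ n f)
  ∏-nonZero zero f f≢0 = 1≢0
  ∏-nonZero (suc n) f f≢0 = *-nonZero (f≢0 zero) (∏-nonZero n (f ∘ suc) (f≢0 ∘ suc))


module Determinant (ℝ : RealField) where
  open FieldProperties ℝ
  open BigOperators ℝ
  open ≡-Reasoning

  Matrix : ℕ → ℕ → Set
  Matrix m n = Fin m → Fin n → Carrier

  Det : ∀ n → Matrix n n → Carrier
  Det = det ℝ

  sg : ∀ {n} → Fin n → Carrier
  sg = sgn ℝ

  minor : ∀ {n} → Matrix (suc n) (suc n) → Fin (suc n) → Matrix n n
  minor M j i l = M (suc i) (punchIn j l)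

  laplaceTerm : ∀ {n} → Matrix (suc n) (suc n) → Fin (suc n) → Carrier
  laplaceTerm {n} M j = sg j * M zero j * Det n (minor M j)

  det-cong : ∀ n {M N : Matrix n n} → (∀ i j → M i j ≡ N i j) → Det n M ≡ Det n N
  det-cong zero M≗N = refl
  det-cong (suc n) M≗N = ∑-cong (suc n) λ j →
    cong₂ _*_ (cong (sg j *_) (M≗N zero j)) (det-cong n (λ i l → M≗N (suc i) (punchIn j l)))

  det-scaleCols : ∀ n (M : Matrix n n) (β : Fin n → Carrier) →
    Det n (λ i j → M i j * β j) ≡ ∏ n β * Det n M
  det-scaleCols zero M β = sym (*-identityˡ 1#)
  det-scaleCols (suc n) M β = begin
    ∑ (suc n) (λ j → sg j * (M zero j * β j) * Det n (λ i l → minor M j i l * β (punchIn j l)))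
      ≡⟨ ∑-cong (suc n) (λ j → cong (sg j * (M zero j * β j) *_) (det-scaleCols n (minor M j) (β ∘ punchIn j))) ⟩
    ∑ (suc n) (λ j → sg j * (M zero j * β j) * (∏ n (β ∘ punchIn j) * Det n (minor M j)))
      ≡⟨ ∑-cong (suc n) (λ j → trans (regroup (sg j) (M zero j) (β j) (∏ n (β ∘ punchIn j)) (Det n (minor M j)))
           (cong (_* laplaceTerm M j) (sym (∏-punchIn n β j)))) ⟩
    ∑ (suc n) (λ j → ∏ (suc n) β * laplaceTerm M j)
      ≡⟨ ∑-*ˡ (suc n) (∏ (suc n) β) (laplaceTerm M) ⟩
    ∏ (suc n) β * Det (suc n) M ∎
    where
    regroup : ∀ s m b p d → s * (m * b) * (p * d) ≡ (b * p) * (s * m * d)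
    regroup = solve 5 (λ s m b p d → s :* (m :* b) :* (p :* d) := (b :* p) :* (s :* m :* d)) refl

  det-scaleRows : ∀ n (M : Matrix n n) (α : Fin n → Carrier) →
    Det n (λ i j → α i * M i j) ≡ ∏ n α * Det n M
  det-scaleRows zero M α = sym (*-identityˡ 1#)
  det-scaleRows (suc n) M α = begin
    ∑ (suc n) (λ j → sg j * (α zero * M zero j) * Det n (λ i l → α (suc i) * minor M j i l))
      ≡⟨ ∑-cong (suc n) (λ j → cong (sg j * (α zero * M zero j) *_) (det-scaleRows n (minor M j) (α ∘ suc))) ⟩
    ∑ (suc n) (λ j → sg j * (α zero * M zero j) * (∏ n (α ∘ suc) * Det n (minor M j)))
      ≡⟨ ∑-cong (suc n) (λ j → regroup (sg j) (α zero) (M zero j) (∏ n (α ∘ suc)) (Det n (minor M j))) ⟩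
    ∑ (suc n) (λ j → ∏ (suc n) α * laplaceTerm M j)
      ≡⟨ ∑-*ˡ (suc n) (∏ (suc n) α) (laplaceTerm M) ⟩
    ∏ (suc n) α * Det (suc n) M ∎
    where
    regroup : ∀ s a m p d → s * (a * m) * (p * d) ≡ (a * p) * (s * m * d)
    regroup = solve 5 (λ s a m p d → s :* (a :* m) :* (p :* d) := (a :* p) :* (s :* m :* d)) refl

  det-zeroCol₀ : ∀ n (M : Matrix (suc n) (suc n)) → (∀ i → M i zero ≡ 0#) → Det (suc n) M ≡ 0#
  det-zeroCol₀ n M col₀≡0 = ∑-zero (suc n) (term≡0 n M col₀≡0)
    where
    term≡0 : ∀ n (M : Matrix (suc n) (suc n)) → (∀ i → M i zero ≡ 0#) → ∀ j → laplaceTerm M j ≡ 0#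
    term≡0 n M col₀≡0 zero = begin
      sg {suc n} zero * M zero zero * Det n (minor M zero) ≡⟨ cong (λ t → sg {suc n} zero * t * Det n (minor M zero)) (col₀≡0 zero) ⟩
      sg {suc n} zero * 0# * Det n (minor M zero)         ≡⟨ cong (_* Det n (minor M zero)) (zeroʳ _) ⟩
      0# * Det n (minor M zero)                           ≡⟨ zeroˡ _ ⟩
      0#                                                  ∎
    term≡0 (suc n) M col₀≡0 (suc j) =
      trans (cong (sg (suc j) * M zero (suc j) *_) (∑-zero (suc n) (term≡0 n (minor M (suc j)) (col₀≡0 ∘ suc))))
            (zeroʳ _)

  det-firstCol : ∀ n (M : Matrix (suc n) (suc n)) → (∀ i → M (suc i) zero ≡ 0#) →
    Det (suc n) M ≡ M zero zero * Det n (λ i l → M (suc i) (suc l))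
  det-firstCol zero M _ = solve 1 (λ m → 𝟙 :* m :* 𝟙 :+ 𝟘 := m :* 𝟙) refl (M zero zero)
  det-firstCol (suc n) M below≡0 = begin
    1# * M zero zero * Det (suc n) (minor M zero) + ∑ (suc n) (laplaceTerm M ∘ suc)
      ≡⟨ cong (1# * M zero zero * Det (suc n) (minor M zero) +_) (∑-zero (suc n) (λ j →
           trans (cong (sg (suc j) * M zero (suc j) *_) (det-zeroCol₀ n (minor M (suc j)) below≡0)) (zeroʳ _))) ⟩
    1# * M zero zero * Det (suc n) (minor M zero) + 0#
      ≡⟨ solve 2 (λ m d → 𝟙 :* m :* d :+ 𝟘 := m :* d) refl (M zero zero) _ ⟩
    M zero zero * Det (suc n) (minor M zero) ∎

  setRow : ∀ {m n} → Matrix m n → Fin m → (Fin n → Carrier) → Matrix m n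
  setRow M zero v zero = v
  setRow M zero v (suc i) = M (suc i)
  setRow M (suc r) v zero = M zero
  setRow M (suc r) v (suc i) = setRow (M ∘ suc) r v i

  setRow-cols : ∀ {m n k} (M : Matrix m n) r v (f : Fin k → Fin n) i l →
    setRow M r v i (f l) ≡ setRow (λ i → M i ∘ f) r (v ∘ f) i l
  setRow-cols M zero v f zero l = refl
  setRow-cols M zero v f (suc i) l = refl
  setRow-cols M (suc r) v f zero l = refl
  setRow-cols M (suc r) v f (suc i) l = setRow-cols (M ∘ suc) r v f i l

  setRow-cong : ∀ {m n} (M : Matrix m n) r {v w} → (∀ l → v l ≡ w l) → ∀ i l → setRow M r v i l ≡ setRow M r w i l
  setRow-cong M zero v≗w zero l = v≗w l
  setRow-cong M zero v≗w (suc i) l = refl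
  setRow-cong M (suc r) v≗w zero l = refl
  setRow-cong M (suc r) v≗w (suc i) l = setRow-cong (M ∘ suc) r v≗w i l

  setRow-self : ∀ {m n} (M : Matrix m n) r i l → setRow M r (M r) i l ≡ M i l
  setRow-self M zero zero l = refl
  setRow-self M zero (suc i) l = refl
  setRow-self M (suc r) zero l = refl
  setRow-self M (suc r) (suc i) l = setRow-self (M ∘ suc) r i l

  setRow-at : ∀ {m n} (M : Matrix m n) r v l → setRow M r v r l ≡ v l
  setRow-at M zero v l = refl
  setRow-at M (suc r) v l = setRow-at (M ∘ suc) r v l

  setRow-other : ∀ {m n} (M : Matrix m n) r v i → ¬ (i ≡ r) → ∀ l → setRow M r v i l ≡ M i l
  setRow-other M zero v zero i≢r l = ⊥-elim (i≢r refl)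
  setRow-other M zero v (suc i) i≢r l = refl
  setRow-other M (suc r) v zero i≢r l = refl
  setRow-other M (suc r) v (suc i) i≢r l = setRow-other (M ∘ suc) r v i (i≢r ∘ cong suc) l

  det-linear : ∀ n (M : Matrix n n) r u w x y →
    Det n (setRow M r (λ l → x * u l + y * w l)) ≡ x * Det n (setRow M r u) + y * Det n (setRow M r w)
  det-linear (suc n) M zero u w x y = ∑-linear (suc n) x y λ j →
    solve 6 (λ s x y u w d → s :* (x :* u :+ y :* w) :* d := x :* (s :* u :* d) :+ y :* (s :* w :* d)) refl
      (sg j) x y (u j) (w j) (Det n (minor M j))
  det-linear (suc n) M (suc r) u w x y = ∑-linear (suc n) x y λ j → begin
    sg j * M zero j * Det n (λ i l → setRow (M ∘ suc) r v i (punchIn j l))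
      ≡⟨ cong (sg j * M zero j *_) (minor-setRow v j) ⟩
    sg j * M zero j * Det n (setRow (minor M j) r (v ∘ punchIn j))
      ≡⟨ cong (sg j * M zero j *_) (det-linear n (minor M j) r (u ∘ punchIn j) (w ∘ punchIn j) x y) ⟩
    sg j * M zero j * (x * Det n (setRow (minor M j) r (u ∘ punchIn j)) + y * Det n (setRow (minor M j) r (w ∘ punchIn j)))
      ≡⟨ solve 6 (λ s m x y a b → s :* m :* (x :* a :+ y :* b) := x :* (s :* m :* a) :+ y :* (s :* m :* b)) refl
           (sg j) (M zero j) x y _ _ ⟩
    x * (sg j * M zero j * Det n (setRow (minor M j) r (u ∘ punchIn j)))
      + y * (sg j * M zero j * Det n (setRow (minor M j) r (w ∘ punchIn j)))
      ≡⟨ sym (cong₂ (λ a b → x * (sg j * M zero j * a) + y * (sg j * M zero j * b)) (minor-setRow u j) (minor-setRow w j)) ⟩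
    x * (sg j * M zero j * Det n (λ i l → setRow (M ∘ suc) r u i (punchIn j l)))
      + y * (sg j * M zero j * Det n (λ i l → setRow (M ∘ suc) r w i (punchIn j l))) ∎
    where
    v = λ l → x * u l + y * w l
    minor-setRow : ∀ v j → Det n (λ i l → setRow (M ∘ suc) r v i (punchIn j l)) ≡ Det n (setRow (minor M j) r (v ∘ punchIn j))
    minor-setRow v j = det-cong n (setRow-cols (M ∘ suc) r v (punchIn j))

  Extensional : ∀ {n k} → ((Fin n → Fin k) → Carrier) → Set
  Extensional G = ∀ τ τ′ → (∀ z → τ z ≡ τ′ z) → G τ ≡ G τ′

  lift-extensional : ∀ {n k} {G : (Fin (suc n) → Fin (suc k)) → Carrier} → Extensional G → Extensional (G ∘ F.lift 1)
  lift-extensional G-ext τ τ′ τ≗τ′ = G-ext _ _ λ { zero → refl ; (suc z) → cong suc (τ≗τ′ z) }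

  -- Laplace expansion along two rows x and y; G τ is the complementary minor on the columns τ.
  expand₂ : ∀ n → (x y : Fin (suc (suc n)) → Carrier) → ((Fin n → Fin (suc (suc n))) → Carrier) → Carrier
  expand₂ n x y G = ∑ (suc (suc n)) λ j → sg j * x j * ∑ (suc n) λ l → sg l * y (punchIn j l) * G (punchIn j ∘ punchIn l)

  expand₂-col₀ : ∀ n → (x y : Fin (suc (suc n)) → Carrier) → ((Fin n → Fin (suc (suc n))) → Carrier) → Carrier
  expand₂-col₀ n x y G = ∑ (suc n) λ l → sg l * (x zero * y (suc l) - x (suc l) * y zero) * G (suc ∘ punchIn l)

  expand₂-rest : ∀ n → (x y : Fin (suc (suc n)) → Carrier) → ((Fin n → Fin (suc (suc n))) → Carrier) → Carrier
  expand₂-rest n x y G = ∑ (suc n) λ j → sg (suc j) * x (suc j) *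
    ∑ n λ l → sg (suc l) * y (punchIn (suc j) (suc l)) * G (punchIn (suc j) ∘ punchIn (suc l))

  expand₂-split : ∀ n x y G → expand₂ n x y G ≡ expand₂-col₀ n x y G + expand₂-rest n x y G
  expand₂-split n x y G = begin
    expand₂ n x y G
      ≡⟨ cong (sg {suc (suc n)} zero * x zero * S₀ +_)
           (∑-cong (suc n) (λ j → distribˡ (sg (suc j) * x (suc j)) (1# * y zero * G₀ j) (inner j))) ⟩
    sg {suc (suc n)} zero * x zero * S₀ + ∑ (suc n) (λ j → A j + B j)
      ≡⟨ cong (sg {suc (suc n)} zero * x zero * S₀ +_) (∑-+ (suc n) A B) ⟩
    1# * x zero * S₀ + (∑ (suc n) A + ∑ (suc n) B)
      ≡⟨ sym (+-assoc _ _ _) ⟩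
    (1# * x zero * S₀ + ∑ (suc n) A) + ∑ (suc n) B
      ≡⟨ cong (_+ ∑ (suc n) B) (sym (trans (∑-+ (suc n) (λ l → x zero * (sg l * y (suc l) * G₀ l)) A)
           (cong (_+ ∑ (suc n) A) (trans (∑-*ˡ (suc n) (x zero) (λ l → sg l * y (suc l) * G₀ l))
                                        (cong (_* S₀) (sym (*-identityˡ _))))))) ⟩
    ∑ (suc n) (λ l → x zero * (sg l * y (suc l) * G₀ l) + A l) + ∑ (suc n) B
      ≡⟨ cong (_+ ∑ (suc n) B) (∑-cong (suc n) λ l →
           solve 6 (λ x₀ s yₗ xₗ y₀ g → x₀ :* (s :* yₗ :* g) :+ (:- s) :* xₗ :* (𝟙 :* y₀ :* g)
                     := s :* (x₀ :* yₗ :- xₗ :* y₀) :* g) refl (x zero) (sg l) (y (suc l)) (x (suc l)) (y zero) (G₀ l)) ⟩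
    expand₂-col₀ n x y G + expand₂-rest n x y G ∎
    where
    G₀ : Fin (suc n) → Carrier
    G₀ l = G (suc ∘ punchIn l)
    S₀ = ∑ (suc n) (λ l → sg l * y (suc l) * G₀ l)
    A : Fin (suc n) → Carrier
    A j = sg (suc j) * x (suc j) * (1# * y zero * G₀ j)
    inner : Fin (suc n) → Carrier
    inner j = ∑ n (λ l → sg (suc l) * y (punchIn (suc j) (suc l)) * G (punchIn (suc j) ∘ punchIn (suc l)))
    B : Fin (suc n) → Carrier
    B j = sg (suc j) * x (suc j) * inner j

  expand₂-rest-zero : ∀ x y G → expand₂-rest zero x y G ≡ 0#
  expand₂-rest-zero x y G = trans (cong (_+ 0#) (zeroʳ _)) (+-identityˡ 0#)

  expand₂-rest-suc : ∀ n x y G → Extensional G →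
    expand₂-rest (suc n) x y G ≡ expand₂ n (x ∘ suc) (y ∘ suc) (G ∘ F.lift 1)
  expand₂-rest-suc n x y G G-ext = ∑-cong (suc (suc n)) λ j → begin
    sg (suc j) * x (suc j) * ∑ (suc n) (λ l → sg (suc l) * y (punchIn (suc j) (suc l)) * G (punchIn (suc j) ∘ punchIn (suc l)))
      ≡⟨ cong (sg (suc j) * x (suc j) *_) (∑-cong (suc n) λ l →
           trans (cong (sg (suc l) * y (punchIn (suc j) (suc l)) *_) (G-ext _ _ (punchIn-lift j l)))
                 (solve 3 (λ s a b → (:- s) :* a :* b := -𝟙 :* (s :* a :* b)) refl (sg l) _ _)) ⟩
    sg (suc j) * x (suc j) * ∑ (suc n) (λ l → - 1# * inner j l)
      ≡⟨ cong (sg (suc j) * x (suc j) *_) (∑-*ˡ (suc n) (- 1#) (inner j)) ⟩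
    sg (suc j) * x (suc j) * (- 1# * ∑ (suc n) (inner j))
      ≡⟨ solve 3 (λ s a b → (:- s) :* a :* (-𝟙 :* b) := s :* a :* b) refl (sg j) (x (suc j)) _ ⟩
    sg j * x (suc j) * ∑ (suc n) (inner j) ∎
    where
    inner : Fin (suc (suc n)) → Fin (suc n) → Carrier
    inner j l = sg l * y (suc (punchIn j l)) * G (F.lift 1 (punchIn j ∘ punchIn l))
    punchIn-lift : ∀ j l z → punchIn (suc j) (punchIn (suc l) z) ≡ F.lift 1 (punchIn j ∘ punchIn l) z
    punchIn-lift j l zero = refl
    punchIn-lift j l (suc z) = refl

  expand₂-diag : ∀ n x G → Extensional G → expand₂ n x x G ≡ 0#
  expand₂-diag n x G G-ext = begin
    expand₂ n x x G                              ≡⟨ expand₂-split n x x G ⟩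
    expand₂-col₀ n x x G + expand₂-rest n x x G  ≡⟨ cong₂ _+_ col₀≡0 (rest≡0 n x G G-ext) ⟩
    0# + 0#                                      ≡⟨ +-identityˡ 0# ⟩
    0#                                           ∎
    where
    col₀≡0 : expand₂-col₀ n x x G ≡ 0#
    col₀≡0 = ∑-zero (suc n) λ l →
      solve 4 (λ s x₀ xₗ g → s :* (x₀ :* xₗ :- xₗ :* x₀) :* g := 𝟘) refl (sg l) (x zero) (x (suc l)) (G (suc ∘ punchIn l))
    rest≡0 : ∀ n x G → Extensional G → expand₂-rest n x x G ≡ 0#
    rest≡0 zero x G G-ext = expand₂-rest-zero x x G
    rest≡0 (suc n) x G G-ext =
      trans (expand₂-rest-suc n x x G G-ext) (expand₂-diag n (x ∘ suc) (G ∘ F.lift 1) (lift-extensional G-ext))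

  expand₂-antisym : ∀ n x y G → Extensional G → expand₂ n x y G + expand₂ n y x G ≡ 0#
  expand₂-antisym n x y G G-ext = begin
    expand₂ n x y G + expand₂ n y x G
      ≡⟨ cong₂ _+_ (expand₂-split n x y G) (expand₂-split n y x G) ⟩
    (expand₂-col₀ n x y G + expand₂-rest n x y G) + (expand₂-col₀ n y x G + expand₂-rest n y x G)
      ≡⟨ solve 4 (λ a b c d → (a :+ b) :+ (c :+ d) := (a :+ c) :+ (b :+ d)) refl _ _ _ _ ⟩
    (expand₂-col₀ n x y G + expand₂-col₀ n y x G) + (expand₂-rest n x y G + expand₂-rest n y x G)
      ≡⟨ cong₂ _+_ col₀≡0 (rest≡0 n x y G G-ext) ⟩
    0# + 0#
      ≡⟨ +-identityˡ 0# ⟩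
    0# ∎
    where
    col₀≡0 : expand₂-col₀ n x y G + expand₂-col₀ n y x G ≡ 0#
    col₀≡0 = trans (sym (∑-+ (suc n) (term x y) (term y x))) (∑-zero (suc n) λ l →
      solve 6 (λ s x₀ yₗ xₗ y₀ g → s :* (x₀ :* yₗ :- xₗ :* y₀) :* g :+ s :* (y₀ :* xₗ :- yₗ :* x₀) :* g := 𝟘) refl
        (sg l) (x zero) (y (suc l)) (x (suc l)) (y zero) (G (suc ∘ punchIn l)))
      where
      term : (x y : Fin (suc (suc n)) → Carrier) → Fin (suc n) → Carrier
      term x y l = sg l * (x zero * y (suc l) - x (suc l) * y zero) * G (suc ∘ punchIn l)
    rest≡0 : ∀ n x y G → Extensional G → expand₂-rest n x y G + expand₂-rest n y x G ≡ 0#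
    rest≡0 zero x y G G-ext = trans (cong₂ _+_ (expand₂-rest-zero x y G) (expand₂-rest-zero y x G)) (+-identityˡ 0#)
    rest≡0 (suc n) x y G G-ext =
      trans (cong₂ _+_ (expand₂-rest-suc n x y G G-ext) (expand₂-rest-suc n y x G G-ext))
            (expand₂-antisym n (x ∘ suc) (y ∘ suc) (G ∘ F.lift 1) (lift-extensional G-ext))

  lowerMinor : ∀ n → Matrix (suc (suc n)) (suc (suc n)) → (Fin n → Fin (suc (suc n))) → Carrier
  lowerMinor n M τ = Det n (λ i l → M (suc (suc i)) (τ l))

  lowerMinor-extensional : ∀ n M → Extensional (lowerMinor n M)
  lowerMinor-extensional n M τ τ′ τ≗τ′ = det-cong n (λ i l → cong (M (suc (suc i))) (τ≗τ′ l))

  det-expand₂ : ∀ n M → Det (suc (suc n)) M ≡ expand₂ n (M zero) (M (suc zero)) (lowerMinor n M)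
  det-expand₂ n M = refl

  swap₀₁ : ∀ {n} → Fin (suc (suc n)) → Fin (suc (suc n))
  swap₀₁ zero = suc zero
  swap₀₁ (suc zero) = zero
  swap₀₁ (suc (suc i)) = suc (suc i)

  -- The transposition of 0 and suc k.
  swap₀ : ∀ {n} → Fin n → Fin (suc n) → Fin (suc n)
  swap₀ {suc n} zero = swap₀₁
  swap₀ {suc n} (suc k) = swap₀₁ ∘ F.lift 1 (swap₀ k) ∘ swap₀₁

  swap₀-zero : ∀ {n} (k : Fin n) → swap₀ k zero ≡ suc k
  swap₀-zero zero = refl
  swap₀-zero (suc k) = cong (swap₀₁ ∘ suc) (swap₀-zero k)

  det-swap₀₁ : ∀ n (M : Matrix (suc (suc n)) (suc (suc n))) → Det (suc (suc n)) (M ∘ swap₀₁) ≡ - Det (suc (suc n)) M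
  det-swap₀₁ n M = x+y≡0⇒x≡-y (expand₂-antisym n (M (suc zero)) (M zero) (lowerMinor n M) (lowerMinor-extensional n M))

  mutual
    det-swap₀ : ∀ n (k : Fin n) (M : Matrix (suc n) (suc n)) → Det (suc n) (M ∘ swap₀ k) ≡ - Det (suc n) M
    det-swap₀ (suc n) zero M = det-swap₀₁ n M
    det-swap₀ (suc n) (suc k) M = begin
      Det (suc (suc n)) (M ∘ swap₀₁ ∘ F.lift 1 (swap₀ k) ∘ swap₀₁) ≡⟨ det-swap₀₁ n (M ∘ swap₀₁ ∘ F.lift 1 (swap₀ k)) ⟩
      - Det (suc (suc n)) (M ∘ swap₀₁ ∘ F.lift 1 (swap₀ k))       ≡⟨ cong -_ (det-lift-swap₀ n k (M ∘ swap₀₁)) ⟩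
      - - Det (suc (suc n)) (M ∘ swap₀₁)                          ≡⟨ -‿involutive _ ⟩
      Det (suc (suc n)) (M ∘ swap₀₁)                              ≡⟨ det-swap₀₁ n M ⟩
      - Det (suc (suc n)) M                                        ∎

    det-lift-swap₀ : ∀ n (k : Fin n) (M : Matrix (suc (suc n)) (suc (suc n))) →
      Det (suc (suc n)) (M ∘ F.lift 1 (swap₀ k)) ≡ - Det (suc (suc n)) M
    det-lift-swap₀ n k M = begin
      ∑ (suc (suc n)) (λ j → sg j * M zero j * Det (suc n) (minor M j ∘ swap₀ k))
        ≡⟨ ∑-cong (suc (suc n)) (λ j → cong (sg j * M zero j *_) (det-swap₀ n k (minor M j))) ⟩
      ∑ (suc (suc n)) (λ j → sg j * M zero j * - Det (suc n) (minor M j))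
        ≡⟨ ∑-cong (suc (suc n)) (λ j → solve 3 (λ s a d → s :* a :* (:- d) := -𝟙 :* (s :* a :* d)) refl
             (sg j) (M zero j) (Det (suc n) (minor M j))) ⟩
      ∑ (suc (suc n)) (λ j → - 1# * laplaceTerm M j)
        ≡⟨ ∑-*ˡ (suc (suc n)) (- 1#) (laplaceTerm M) ⟩
      - 1# * Det (suc (suc n)) M
        ≡⟨ solve 1 (λ d → -𝟙 :* d := :- d) refl _ ⟩
      - Det (suc (suc n)) M ∎

  det-repeatedRow₀ : ∀ n (k : Fin n) (M : Matrix (suc n) (suc n)) → (∀ l → M zero l ≡ M (suc k) l) → Det (suc n) M ≡ 0#
  det-repeatedRow₀ (suc n) zero M row₀≗row₁ = begin
    Det (suc (suc n)) M
      ≡⟨ det-cong (suc (suc n)) row₁≔row₀ ⟩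
    Det (suc (suc n)) (setRow M (suc zero) (M zero))
      ≡⟨ det-expand₂ n (setRow M (suc zero) (M zero)) ⟩
    expand₂ n (M zero) (M zero) (lowerMinor n M)
      ≡⟨ expand₂-diag n (M zero) (lowerMinor n M) (lowerMinor-extensional n M) ⟩
    0# ∎
    where
    row₁≔row₀ : ∀ i l → M i l ≡ setRow M (suc zero) (M zero) i l
    row₁≔row₀ zero l = refl
    row₁≔row₀ (suc zero) l = sym (row₀≗row₁ l)
    row₁≔row₀ (suc (suc i)) l = refl
  det-repeatedRow₀ (suc n) (suc k) M row₀≗rowₖ = -x≡0⇒x≡0 (begin
    - Det (suc (suc n)) M                         ≡⟨ sym (det-lift-swap₀ n k M) ⟩
    Det (suc (suc n)) (M ∘ F.lift 1 (swap₀ k))   ≡⟨ det-repeatedRow₀ (suc n) zero (M ∘ F.lift 1 (swap₀ k)) row₀≗row₁ ⟩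
    0#                                            ∎)
    where
    row₀≗row₁ : ∀ l → M zero l ≡ M (suc (swap₀ k zero)) l
    row₀≗row₁ l = trans (row₀≗rowₖ l) (cong (λ r → M (suc r) l) (sym (swap₀-zero k)))

  det-addRow₀ : ∀ n (k : Fin n) (M : Matrix (suc n) (suc n)) μ →
    Det (suc n) (setRow M (suc k) (λ l → M (suc k) l + μ * M zero l)) ≡ Det (suc n) M
  det-addRow₀ n k M μ = begin
    Det (suc n) (setRow M (suc k) (λ l → M (suc k) l + μ * M zero l))
      ≡⟨ det-cong (suc n) (setRow-cong M (suc k) (λ l → cong (_+ μ * M zero l) (sym (*-identityˡ _)))) ⟩
    Det (suc n) (setRow M (suc k) (λ l → 1# * M (suc k) l + μ * M zero l))
      ≡⟨ det-linear (suc n) M (suc k) (M (suc k)) (M zero) 1# μ ⟩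
    1# * Det (suc n) (setRow M (suc k) (M (suc k))) + μ * Det (suc n) (setRow M (suc k) (M zero))
      ≡⟨ cong₂ (λ a b → 1# * a + μ * b) (det-cong (suc n) (setRow-self M (suc k)))
           (det-repeatedRow₀ n k (setRow M (suc k) (M zero)) (λ l → sym (setRow-at M (suc k) (M zero) l))) ⟩
    1# * Det (suc n) M + μ * 0#
      ≡⟨ solve 2 (λ d m → 𝟙 :* d :+ m :* 𝟘 := d) refl (Det (suc n) M) μ ⟩
    Det (suc n) M ∎

  addMultiplesOfRow₀ : ∀ {n} → (Fin n → Carrier) → Matrix (suc n) (suc n) → Matrix (suc n) (suc n)
  addMultiplesOfRow₀ μ M zero l = M zero l
  addMultiplesOfRow₀ μ M (suc i) l = M (suc i) l + μ i * M zero l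

  ifᵈ_then_else_ : ∀ {P : Set} → Dec P → Carrier → Carrier → Carrier
  ifᵈ yes _ then x else y = x
  ifᵈ no _ then x else y = y

  ifᵈ-yes : ∀ {P : Set} (p? : Dec P) {x y} → P → (ifᵈ p? then x else y) ≡ x
  ifᵈ-yes (yes _) p = refl
  ifᵈ-yes (no ¬p) p = ⊥-elim (¬p p)

  ifᵈ-no : ∀ {P : Set} (p? : Dec P) {x y} → ¬ P → (ifᵈ p? then x else y) ≡ y
  ifᵈ-no (yes p) ¬p = ⊥-elim (¬p p)
  ifᵈ-no (no _) ¬p = refl

  det-addMultiplesOfRow₀ : ∀ n μ (M : Matrix (suc n) (suc n)) → Det (suc n) (addMultiplesOfRow₀ μ M) ≡ Det (suc n) M
  det-addMultiplesOfRow₀ n μ M = trans (det-cong (suc n) all-rows) (det-partial n ℕP.≤-refl)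
    where
    added : Fin n → Fin (suc n) → Carrier
    added i l = M (suc i) l + μ i * M zero l
    partial : ℕ → Matrix (suc n) (suc n)
    partial t zero l = M zero l
    partial t (suc i) l = ifᵈ (toℕ i ℕ.<? t) then added i l else M (suc i) l

    all-rows : ∀ i l → addMultiplesOfRow₀ μ M i l ≡ partial n i l
    all-rows zero l = refl
    all-rows (suc i) l = sym (ifᵈ-yes (toℕ i ℕ.<? n) (FP.toℕ<n i))

    no-rows : ∀ i l → partial 0 i l ≡ M i l
    no-rows zero l = refl
    no-rows (suc i) l = refl

    one-more-row : ∀ t (t<n : t ℕ.< n) i l →
      partial (suc t) i l ≡ setRow (partial t) (suc (F.fromℕ< t<n)) (λ l → partial t (suc (F.fromℕ< t<n)) l + μ (F.fromℕ< t<n) * M zero l) i l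
    one-more-row t t<n zero l = refl
    one-more-row t t<n (suc i) l with i F.≟ F.fromℕ< t<n
    ... | yes refl = begin
      ifᵈ (toℕ i ℕ.<? suc t) then added i l else M (suc i) l ≡⟨ ifᵈ-yes (toℕ i ℕ.<? suc t) (ℕP.≤-reflexive (cong suc i≡t)) ⟩
      added i l                                              ≡⟨ cong (_+ μ i * M zero l) (sym (ifᵈ-no (toℕ i ℕ.<? t) (ℕP.<-irrefl i≡t))) ⟩
      partial t (suc i) l + μ i * M zero l                   ≡⟨ sym (setRow-at (partial t) (suc i) _ l) ⟩
      setRow (partial t) (suc i) (λ l → partial t (suc i) l + μ i * M zero l) (suc i) l ∎
      where
      i≡t : toℕ i ≡ t
      i≡t = FP.toℕ-fromℕ< t<n
    ... | no i≢t = trans (same-choice (toℕ i ℕ.<? suc t) (toℕ i ℕ.<? t))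
                         (sym (setRow-other (partial t) (suc (F.fromℕ< t<n)) _ (suc i) (i≢t ∘ FP.suc-injective) l))
      where
      toℕi≢t : ¬ (toℕ i ≡ t)
      toℕi≢t i≡t = i≢t (FP.toℕ-injective (trans i≡t (sym (FP.toℕ-fromℕ< t<n))))
      same-choice : ∀ (p? : Dec (toℕ i ℕ.< suc t)) (q? : Dec (toℕ i ℕ.< t)) →
        (ifᵈ p? then added i l else M (suc i) l) ≡ (ifᵈ q? then added i l else M (suc i) l)
      same-choice (yes _) (yes _) = refl
      same-choice (no _) (no _) = refl
      same-choice (yes i<1+t) (no i≮t) = ⊥-elim (toℕi≢t (ℕP.≤-antisym (ℕ.s≤s⁻¹ i<1+t) (ℕP.≮⇒≥ i≮t)))
      same-choice (no i≮1+t) (yes i<t) = ⊥-elim (i≮1+t (ℕP.m≤n⇒m≤1+n i<t))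

    det-partial : ∀ t → t ℕ.≤ n → Det (suc n) (partial t) ≡ Det (suc n) M
    det-partial zero _ = det-cong (suc n) no-rows
    det-partial (suc t) t<n = begin
      Det (suc n) (partial (suc t))  ≡⟨ det-cong (suc n) (one-more-row t t<n) ⟩
      Det (suc n) (setRow (partial t) (suc (F.fromℕ< t<n)) _) ≡⟨ det-addRow₀ n (F.fromℕ< t<n) (partial t) (μ (F.fromℕ< t<n)) ⟩
      Det (suc n) (partial t)        ≡⟨ det-partial t (ℕP.<⇒≤ t<n) ⟩
      Det (suc n) M                  ∎


module InverseRankTwoDeterminant (ℝ : RealField) where
  open FieldProperties ℝ
  open BigOperators ℝ
  open Determinant ℝ
  open ≡-Reasoning

  -- crossProduct n a b = ∏_{i<j} (a_j b_i − a_i b_j)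
  crossProduct : ∀ n → (a b : Fin n → Carrier) → Carrier
  crossProduct zero a b = 1#
  crossProduct (suc n) a b = ∏ n (λ i → a (suc i) * b zero - a zero * b (suc i)) * crossProduct n (a ∘ suc) (b ∘ suc)

  crossProduct-cong : ∀ n {a a′ b b′ : Fin n → Carrier} → (∀ i → a i ≡ a′ i) → (∀ i → b i ≡ b′ i) →
    crossProduct n a b ≡ crossProduct n a′ b′
  crossProduct-cong zero a≗a′ b≗b′ = refl
  crossProduct-cong (suc n) a≗a′ b≗b′ = cong₂ _*_
    (∏-cong n λ i → cong₂ _-_ (cong₂ _*_ (a≗a′ (suc i)) (b≗b′ zero)) (cong₂ _*_ (a≗a′ zero) (b≗b′ (suc i))))
    (crossProduct-cong n (a≗a′ ∘ suc) (b≗b′ ∘ suc))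

  rank₂ : ∀ {n} (a b g h : Fin n → Carrier) → Matrix n n
  rank₂ a b g h i j = a i * g j + b i * h j

  eliminated-entry : ∀ {u v w} d → NonZero u → NonZero v → NonZero w →
    w ⁻¹ + - (d * u ⁻¹) * v ⁻¹ ≡ (u * v - d * w) * (u ⁻¹ * v ⁻¹ * w ⁻¹)
  eliminated-entry {u} {v} {w} d u≢0 v≢0 w≢0 = sym (begin
    (u * v - d * w) * (u ⁻¹ * v ⁻¹ * w ⁻¹)
      ≡⟨ solve 7 (λ u u′ v v′ w w′ d → (u :* v :- d :* w) :* (u′ :* v′ :* w′)
                   := (u :* u′) :* (v :* v′) :* w′ :- d :* u′ :* v′ :* (w :* w′)) refl u (u ⁻¹) v (v ⁻¹) w (w ⁻¹) d ⟩
    (u * u ⁻¹) * (v * v ⁻¹) * w ⁻¹ - d * u ⁻¹ * v ⁻¹ * (w * w ⁻¹)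
      ≡⟨ cong₂ (λ x y → x * y * w ⁻¹ - d * u ⁻¹ * v ⁻¹ * (w * w ⁻¹)) (inverseʳ u u≢0) (inverseʳ v v≢0) ⟩
    1# * 1# * w ⁻¹ - d * u ⁻¹ * v ⁻¹ * (w * w ⁻¹)
      ≡⟨ cong (λ x → 1# * 1# * w ⁻¹ - d * u ⁻¹ * v ⁻¹ * x) (inverseʳ w w≢0) ⟩
    1# * 1# * w ⁻¹ - d * u ⁻¹ * v ⁻¹ * 1#
      ≡⟨ solve 4 (λ u′ v′ w′ d → 𝟙 :* 𝟙 :* w′ :- d :* u′ :* v′ :* 𝟙
                   := w′ :+ (:- (d :* u′)) :* v′) refl (u ⁻¹) (v ⁻¹) (w ⁻¹) d ⟩
    w ⁻¹ + - (d * u ⁻¹) * v ⁻¹ ∎)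

  -- Clearing the first column of (1 / rank₂ …) with row 0 leaves a matrix of the same shape, rescaled.
  module FirstElimination {n} (a b g h : Fin (suc (suc n)) → Carrier) (E≢0 : ∀ i j → NonZero (rank₂ a b g h i j)) where
    E = rank₂ a b g h
    D = E zero zero
    M = λ i j → E i j ⁻¹
    M′ = λ i j → E (suc i) (suc j) ⁻¹

    X Y α β : Fin (suc n) → Carrier
    X i = a (suc i) * b zero - a zero * b (suc i)
    Y j = h (suc j) * g zero - h zero * g (suc j)
    α i = X i * E (suc i) zero ⁻¹
    β j = Y j * E zero (suc j) ⁻¹

    multiplier : Fin (suc n) → Carrier
    multiplier i = - (D * E (suc i) zero ⁻¹)

    cleared : ∀ i → addMultiplesOfRow₀ multiplier M (suc i) zero ≡ 0#
    cleared i = begin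
      E (suc i) zero ⁻¹ + - (D * E (suc i) zero ⁻¹) * D ⁻¹
        ≡⟨ solve 3 (λ e′ d d′ → e′ :+ :- (d :* e′) :* d′ := e′ :+ :- (e′ :* (d :* d′))) refl (E (suc i) zero ⁻¹) D (D ⁻¹) ⟩
      E (suc i) zero ⁻¹ + - (E (suc i) zero ⁻¹ * (D * D ⁻¹))
        ≡⟨ cong (λ t → E (suc i) zero ⁻¹ + - (E (suc i) zero ⁻¹ * t)) (inverseʳ D (E≢0 zero zero)) ⟩
      E (suc i) zero ⁻¹ + - (E (suc i) zero ⁻¹ * 1#)
        ≡⟨ solve 1 (λ e′ → e′ :+ :- (e′ :* 𝟙) := 𝟘) refl (E (suc i) zero ⁻¹) ⟩
      0# ∎

    remaining : ∀ i l → addMultiplesOfRow₀ multiplier M (suc i) (suc l) ≡ α i * (M′ i l * β l)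
    remaining i l = begin
      E (suc i) (suc l) ⁻¹ + - (D * E (suc i) zero ⁻¹) * E zero (suc l) ⁻¹
        ≡⟨ eliminated-entry D (E≢0 (suc i) zero) (E≢0 zero (suc l)) (E≢0 (suc i) (suc l)) ⟩
      (E (suc i) zero * E zero (suc l) - D * E (suc i) (suc l)) * inverses
        ≡⟨ cong (_* inverses)
             (solve 8 (λ aᵢ a₀ bᵢ b₀ gₗ g₀ hₗ h₀ → (aᵢ :* g₀ :+ bᵢ :* h₀) :* (a₀ :* gₗ :+ b₀ :* hₗ)
                                                    :- (a₀ :* g₀ :+ b₀ :* h₀) :* (aᵢ :* gₗ :+ bᵢ :* hₗ)
                         := (aᵢ :* b₀ :- a₀ :* bᵢ) :* (hₗ :* g₀ :- h₀ :* gₗ)) refl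
               (a (suc i)) (a zero) (b (suc i)) (b zero) (g (suc l)) (g zero) (h (suc l)) (h zero)) ⟩
      (X i * Y l) * inverses
        ≡⟨ solve 5 (λ x y b′ c′ a′ → (x :* y) :* (b′ :* c′ :* a′) := (x :* b′) :* (a′ :* (y :* c′))) refl
             (X i) (Y l) (E (suc i) zero ⁻¹) (E zero (suc l) ⁻¹) (E (suc i) (suc l) ⁻¹) ⟩
      α i * (M′ i l * β l) ∎
      where inverses = E (suc i) zero ⁻¹ * E zero (suc l) ⁻¹ * E (suc i) (suc l) ⁻¹

    det-M : Det (suc (suc n)) M ≡ D ⁻¹ * (∏ (suc n) α * (∏ (suc n) β * Det (suc n) M′))
    det-M = begin
      Det (suc (suc n)) M
        ≡⟨ sym (det-addMultiplesOfRow₀ (suc n) multiplier M) ⟩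
      Det (suc (suc n)) (addMultiplesOfRow₀ multiplier M)
        ≡⟨ det-firstCol (suc n) (addMultiplesOfRow₀ multiplier M) cleared ⟩
      D ⁻¹ * Det (suc n) (λ i l → addMultiplesOfRow₀ multiplier M (suc i) (suc l))
        ≡⟨ cong (D ⁻¹ *_) (det-cong (suc n) remaining) ⟩
      D ⁻¹ * Det (suc n) (λ i l → α i * (M′ i l * β l))
        ≡⟨ cong (D ⁻¹ *_) (det-scaleRows (suc n) (λ i l → M′ i l * β l) α) ⟩
      D ⁻¹ * (∏ (suc n) α * Det (suc n) (λ i l → M′ i l * β l))
        ≡⟨ cong (λ d → D ⁻¹ * (∏ (suc n) α * d)) (det-scaleCols (suc n) M′ β) ⟩
      D ⁻¹ * (∏ (suc n) α * (∏ (suc n) β * Det (suc n) M′)) ∎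

  det-⁻¹-rank₂ : ∀ n (a b g h : Fin (suc n) → Carrier) → (∀ i j → NonZero (rank₂ a b g h i j)) →
    Det (suc n) (λ i j → rank₂ a b g h i j ⁻¹) * ∏ (suc n) (λ i → ∏ (suc n) (rank₂ a b g h i))
      ≡ crossProduct (suc n) a b * crossProduct (suc n) h g
  det-⁻¹-rank₂ zero a b g h E≢0 = begin
    (1# * E ⁻¹ * 1# + 0#) * ((E * 1#) * 1#)
      ≡⟨ solve 2 (λ e e′ → (𝟙 :* e′ :* 𝟙 :+ 𝟘) :* ((e :* 𝟙) :* 𝟙) := e′ :* e) refl E (E ⁻¹) ⟩
    E ⁻¹ * E
      ≡⟨ inverseˡ E (E≢0 zero zero) ⟩
    1#
      ≡⟨ solve 0 (𝟙 := (𝟙 :* 𝟙) :* (𝟙 :* 𝟙)) refl ⟩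
    (1# * 1#) * (1# * 1#) ∎
    where E = rank₂ a b g h zero zero
  det-⁻¹-rank₂ (suc n) a b g h E≢0 = begin
    Det (suc (suc n)) M * ∏∏E
      ≡⟨ cong₂ _*_ det-M ∏∏E-split ⟩
    D ⁻¹ * (∏ (suc n) α * (∏ (suc n) β * Det (suc n) M′)) * ((D * ∏ (suc n) E₀) * (∏ (suc n) Eₛ * ∏∏E′))
      ≡⟨ solve 8 (λ d′ pα pβ dM d pE₀ pEₛ pp → d′ :* (pα :* (pβ :* dM)) :* ((d :* pE₀) :* (pEₛ :* pp))
                   := (d′ :* d) :* (pα :* pEₛ) :* (pβ :* pE₀) :* (dM :* pp)) refl
           (D ⁻¹) (∏ (suc n) α) (∏ (suc n) β) (Det (suc n) M′) D (∏ (suc n) E₀) (∏ (suc n) Eₛ) ∏∏E′ ⟩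
    (D ⁻¹ * D) * (∏ (suc n) α * ∏ (suc n) Eₛ) * (∏ (suc n) β * ∏ (suc n) E₀) * (Det (suc n) M′ * ∏∏E′)
      ≡⟨ cong₂ (λ u v → u * v * (∏ (suc n) β * ∏ (suc n) E₀) * (Det (suc n) M′ * ∏∏E′))
           (inverseˡ D (E≢0 zero zero))
           (trans (sym (∏-* (suc n) α Eₛ)) (∏-cong (suc n) (λ i → x*y⁻¹*y≡x (X i) (E≢0 (suc i) zero)))) ⟩
    1# * ∏ (suc n) X * (∏ (suc n) β * ∏ (suc n) E₀) * (Det (suc n) M′ * ∏∏E′)
      ≡⟨ cong₂ (λ u v → 1# * ∏ (suc n) X * u * v)
           (trans (sym (∏-* (suc n) β E₀)) (∏-cong (suc n) (λ j → x*y⁻¹*y≡x (Y j) (E≢0 zero (suc j)))))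
           (det-⁻¹-rank₂ n (a ∘ suc) (b ∘ suc) (g ∘ suc) (h ∘ suc) (λ i j → E≢0 (suc i) (suc j))) ⟩
    1# * ∏ (suc n) X * ∏ (suc n) Y * (crossProduct (suc n) (a ∘ suc) (b ∘ suc) * crossProduct (suc n) (h ∘ suc) (g ∘ suc))
      ≡⟨ solve 4 (λ x y v w → 𝟙 :* x :* y :* (v :* w) := (x :* v) :* (y :* w)) refl _ _ _ _ ⟩
    crossProduct (suc (suc n)) a b * crossProduct (suc (suc n)) h g ∎
    where
    open FirstElimination a b g h E≢0
    E₀ Eₛ : Fin (suc n) → Carrier
    E₀ j = E zero (suc j)
    Eₛ i = E (suc i) zero
    ∏∏E = ∏ (suc (suc n)) (λ i → ∏ (suc (suc n)) (E i))
    ∏∏E′ = ∏ (suc n) (λ i → ∏ (suc n) (E (suc i) ∘ suc))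
    ∏∏E-split : ∏∏E ≡ (D * ∏ (suc n) E₀) * (∏ (suc n) Eₛ * ∏∏E′)
    ∏∏E-split = cong ((D * ∏ (suc n) E₀) *_) (∏-* (suc n) Eₛ (λ i → ∏ (suc n) (E (suc i) ∘ suc)))

module IntegerPowers (ℝ : RealField) where
  open FieldProperties ℝ
  open ≡-Reasoning

  _^ℕ_ : Carrier → ℕ → Carrier
  x ^ℕ n = _^_ ℝ x n

  _^ℤ_ : Carrier → ℤ → Carrier
  x ^ℤ i = _^ᶻ_ ℝ x i

  ^ℕ-nonZero : ∀ {x} → NonZero x → ∀ n → NonZero (x ^ℕ n)
  ^ℕ-nonZero x≢0 zero = 1≢0
  ^ℕ-nonZero x≢0 (suc n) = *-nonZero x≢0 (^ℕ-nonZero x≢0 n)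

  ^ℕ-+ : ∀ x m n → x ^ℕ (m ℕ.+ n) ≡ x ^ℕ m * x ^ℕ n
  ^ℕ-+ x zero n = sym (*-identityˡ _)
  ^ℕ-+ x (suc m) n = trans (cong (x *_) (^ℕ-+ x m n)) (sym (*-assoc _ _ _))

  ^ℤ-suc : ∀ {x} → NonZero x → ∀ i → x ^ℤ ℤ.suc i ≡ x * x ^ℤ i
  ^ℤ-suc x≢0 (ℤ.+ n) = refl
  ^ℤ-suc x≢0 -[1+ zero ] = sym (trans (x*[x*y]⁻¹≡y⁻¹ x≢0 1≢0) 1⁻¹≡1)
  ^ℤ-suc x≢0 -[1+ suc n ] = sym (x*[x*y]⁻¹≡y⁻¹ x≢0 (^ℕ-nonZero x≢0 (suc n)))

  geometric : ∀ (Z : ℤ → Carrier) r → NonZero r → (∀ t → Z (ℤ.suc t) ≡ r * Z t) → ∀ t → Z t ≡ r ^ℤ t * Z (ℤ.+ 0)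
  geometric Z r r≢0 step (ℤ.+ zero) = sym (*-identityˡ _)
  geometric Z r r≢0 step (ℤ.+ suc n) = trans (step (ℤ.+ n)) (trans (cong (r *_) (geometric Z r r≢0 step (ℤ.+ n))) (sym (*-assoc _ _ _)))
  geometric Z r r≢0 step -[1+ n ] = *-cancelˡ r≢0 (begin
    r * Z -[1+ n ]                    ≡⟨ sym (step -[1+ n ]) ⟩
    Z (ℤ.suc -[1+ n ])                ≡⟨ geometric-suc n ⟩
    r ^ℤ ℤ.suc -[1+ n ] * Z (ℤ.+ 0)   ≡⟨ cong (_* Z (ℤ.+ 0)) (^ℤ-suc r≢0 -[1+ n ]) ⟩
    (r * r ^ℤ -[1+ n ]) * Z (ℤ.+ 0)   ≡⟨ *-assoc _ _ _ ⟩
    r * (r ^ℤ -[1+ n ] * Z (ℤ.+ 0))   ∎)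
    where
    geometric-suc : ∀ n → Z (ℤ.suc -[1+ n ]) ≡ r ^ℤ ℤ.suc -[1+ n ] * Z (ℤ.+ 0)
    geometric-suc zero = sym (*-identityˡ _)
    geometric-suc (suc n) = geometric Z r r≢0 step -[1+ n ]

  ^ℤ-+ : ∀ {x} → NonZero x → ∀ i j → x ^ℤ (i ℤ.+ j) ≡ x ^ℤ i * x ^ℤ j
  ^ℤ-+ {x} x≢0 i j = begin
    x ^ℤ (i ℤ.+ j)                 ≡⟨ geometric (λ j → x ^ℤ (i ℤ.+ j)) x x≢0 step j ⟩
    x ^ℤ j * x ^ℤ (i ℤ.+ ℤ.+ 0)    ≡⟨ cong (λ k → x ^ℤ j * x ^ℤ k) (ℤP.+-identityʳ i) ⟩
    x ^ℤ j * x ^ℤ i                ≡⟨ *-comm _ _ ⟩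
    x ^ℤ i * x ^ℤ j                ∎
    where
    step : ∀ t → x ^ℤ (i ℤ.+ ℤ.suc t) ≡ x * x ^ℤ (i ℤ.+ t)
    step t = trans (cong (x ^ℤ_) (ℤ+-suc i t)) (^ℤ-suc x≢0 (i ℤ.+ t))

  1^ℤ : ∀ i → 1# ^ℤ i ≡ 1#
  1^ℤ i = sym (trans (geometric (λ _ → 1#) 1# 1≢0 (λ _ → sym (*-identityˡ 1#)) i) (*-identityʳ _))

  ^ℤ-distrib-* : ∀ {x y} → NonZero x → NonZero y → ∀ i → (x * y) ^ℤ i ≡ x ^ℤ i * y ^ℤ i
  ^ℤ-distrib-* {x} {y} x≢0 y≢0 i = sym (trans (geometric (λ i → x ^ℤ i * y ^ℤ i) (x * y) (*-nonZero x≢0 y≢0) step i)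
                                            (solve 1 (λ t → t :* (𝟙 :* 𝟙) := t) refl _))
    where
    step : ∀ t → x ^ℤ ℤ.suc t * y ^ℤ ℤ.suc t ≡ (x * y) * (x ^ℤ t * y ^ℤ t)
    step t = trans (cong₂ _*_ (^ℤ-suc x≢0 t) (^ℤ-suc y≢0 t))
                   (solve 4 (λ x y a b → (x :* a) :* (y :* b) := (x :* y) :* (a :* b)) refl x y (x ^ℤ t) (y ^ℤ t))

  ^ℤ-^ℕ : ∀ {x} → NonZero x → ∀ i n → (x ^ℤ i) ^ℕ n ≡ x ^ℤ (ℤ.+ n ℤ.* i)
  ^ℤ-^ℕ {x} x≢0 i zero = sym (cong (x ^ℤ_) (ℤP.*-zeroˡ i))
  ^ℤ-^ℕ {x} x≢0 i (suc n) = begin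
    x ^ℤ i * (x ^ℤ i) ^ℕ n        ≡⟨ cong (x ^ℤ i *_) (^ℤ-^ℕ x≢0 i n) ⟩
    x ^ℤ i * x ^ℤ (ℤ.+ n ℤ.* i)   ≡⟨ sym (^ℤ-+ x≢0 i (ℤ.+ n ℤ.* i)) ⟩
    x ^ℤ (i ℤ.+ ℤ.+ n ℤ.* i)      ≡⟨ cong (x ^ℤ_) (sym (ℤP.suc-* (ℤ.+ n) i)) ⟩
    x ^ℤ (ℤ.+ suc n ℤ.* i)        ∎

  [-1]^ℤ-even : ∀ i → (- 1#) ^ℤ (ℤ.+ 2 ℤ.* i) ≡ 1#
  [-1]^ℤ-even i = begin
    (- 1#) ^ℤ (ℤ.+ 2 ℤ.* i)         ≡⟨ cong ((- 1#) ^ℤ_) (solveℤ 1 (λ i → conᶻ (ℤ.+ 2) :*ᶻ i :=ᶻ i :+ᶻ i) refl i) ⟩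
    (- 1#) ^ℤ (i ℤ.+ i)             ≡⟨ ^ℤ-+ -1≢0 i i ⟩
    (- 1#) ^ℤ i * (- 1#) ^ℤ i       ≡⟨ sym (^ℤ-distrib-* -1≢0 -1≢0 i) ⟩
    (- 1# * - 1#) ^ℤ i              ≡⟨ cong (_^ℤ i) (solve 0 (-𝟙 :* -𝟙 := 𝟙) refl) ⟩
    1# ^ℤ i                         ≡⟨ 1^ℤ i ⟩
    1#                              ∎

  [-x]^ℤ : ∀ {x} → NonZero x → ∀ i j → (- x) ^ℤ (i ℤ.+ ℤ.+ 2 ℤ.* j) ≡ (- 1#) ^ℤ i * x ^ℤ (i ℤ.+ ℤ.+ 2 ℤ.* j)
  [-x]^ℤ {x} x≢0 i j = begin
    (- x) ^ℤ e                                ≡⟨ cong (_^ℤ e) (solve 1 (λ x → :- x := -𝟙 :* x) refl x) ⟩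
    (- 1# * x) ^ℤ e                           ≡⟨ ^ℤ-distrib-* -1≢0 x≢0 e ⟩
    (- 1#) ^ℤ e * x ^ℤ e                      ≡⟨ cong (_* x ^ℤ e) (^ℤ-+ -1≢0 i (ℤ.+ 2 ℤ.* j)) ⟩
    (- 1#) ^ℤ i * (- 1#) ^ℤ (ℤ.+ 2 ℤ.* j) * x ^ℤ e ≡⟨ cong (λ y → (- 1#) ^ℤ i * y * x ^ℤ e) ([-1]^ℤ-even j) ⟩
    (- 1#) ^ℤ i * 1# * x ^ℤ e                 ≡⟨ cong (_* x ^ℤ e) (*-identityʳ _) ⟩
    (- 1#) ^ℤ i * x ^ℤ e                      ∎
    where e = i ℤ.+ ℤ.+ 2 ℤ.* j


module LinearRecurrence (ℝ : RealField) (x a b c : RealField.Carrier ℝ) (c≢0 : ¬ (c ≡ RealField.0# ℝ)) where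
  open FieldProperties ℝ
  open IntegerPowers ℝ
  open ≡-Reasoning

  A : Carrier
  A = a * x + b

  Recurrent : (ℤ → Carrier) → Set
  Recurrent X = ∀ t → X (ℤ.suc (ℤ.suc t)) ≡ A * X (ℤ.suc t) + c * X t

  -- c ≢ 0 lets the recurrence run backwards.
  recurrent-unique : ∀ X Y → Recurrent X → Recurrent Y → X (ℤ.+ 0) ≡ Y (ℤ.+ 0) → X (ℤ.+ 1) ≡ Y (ℤ.+ 1) → ∀ t → X t ≡ Y t
  recurrent-unique X Y X-rec Y-rec X₀≡Y₀ X₁≡Y₁ = agree
    where
    forward : ∀ n → X (ℤ.+ n) ≡ Y (ℤ.+ n) × X (ℤ.+ suc n) ≡ Y (ℤ.+ suc n)
    forward zero = X₀≡Y₀ , X₁≡Y₁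
    forward (suc n) = proj₂ (forward n) ,
      trans (X-rec (ℤ.+ n)) (trans (cong₂ (λ u v → A * u + c * v) (proj₂ (forward n)) (proj₁ (forward n))) (sym (Y-rec (ℤ.+ n))))
    step-back : ∀ t → X (ℤ.suc t) ≡ Y (ℤ.suc t) → X (ℤ.suc (ℤ.suc t)) ≡ Y (ℤ.suc (ℤ.suc t)) → X t ≡ Y t
    step-back t eq₁ eq₂ = *-cancelˡ c≢0 (begin
      c * X t                                           ≡⟨ solve 3 (λ u v w → w := (v :* u :+ w) :- v :* u) refl (X (ℤ.suc t)) A (c * X t) ⟩
      (A * X (ℤ.suc t) + c * X t) - A * X (ℤ.suc t)     ≡⟨ cong₂ (λ u v → u - A * v) (sym (X-rec t)) eq₁ ⟩
      X (ℤ.suc (ℤ.suc t)) - A * Y (ℤ.suc t)             ≡⟨ cong (_- A * Y (ℤ.suc t)) (trans eq₂ (Y-rec t)) ⟩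
      (A * Y (ℤ.suc t) + c * Y t) - A * Y (ℤ.suc t)     ≡⟨ solve 3 (λ u v w → (v :* u :+ w) :- v :* u := w) refl (Y (ℤ.suc t)) A (c * Y t) ⟩
      c * Y t                                           ∎)
    backward : ∀ n → X -[1+ n ] ≡ Y -[1+ n ] × X (ℤ.suc -[1+ n ]) ≡ Y (ℤ.suc -[1+ n ])
    backward zero = step-back -[1+ 0 ] X₀≡Y₀ X₁≡Y₁ , X₀≡Y₀
    backward (suc n) = step-back -[1+ suc n ] (proj₁ (backward n)) (proj₂ (backward n)) , proj₁ (backward n)
    agree : ∀ t → X t ≡ Y t
    agree (ℤ.+ n) = proj₁ (forward n)
    agree -[1+ n ] = proj₁ (backward n)

  recurrent-cong : ∀ {X Y} → Recurrent X → (∀ t → X t ≡ Y t) → Recurrent Y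
  recurrent-cong X-rec X≗Y t = trans (sym (X≗Y _)) (trans (X-rec t) (cong₂ (λ u v → A * u + c * v) (X≗Y _) (X≗Y t)))

  recurrent-shift : ∀ {X} → Recurrent X → ∀ s → Recurrent (λ t → X (s ℤ.+ t))
  recurrent-shift {X} X-rec s t = begin
    X (s ℤ.+ ℤ.suc (ℤ.suc t))                      ≡⟨ cong X (trans (ℤ+-suc s (ℤ.suc t)) (cong ℤ.suc (ℤ+-suc s t))) ⟩
    X (ℤ.suc (ℤ.suc (s ℤ.+ t)))                    ≡⟨ X-rec (s ℤ.+ t) ⟩
    A * X (ℤ.suc (s ℤ.+ t)) + c * X (s ℤ.+ t)      ≡⟨ cong (λ u → A * X u + c * X (s ℤ.+ t)) (sym (ℤ+-suc s t)) ⟩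
    A * X (s ℤ.+ ℤ.suc t) + c * X (s ℤ.+ t)        ∎

  recurrent-lincomb : ∀ {X Y} α β → Recurrent X → Recurrent Y → Recurrent (λ t → α * X t + β * Y t)
  recurrent-lincomb {X} {Y} α β X-rec Y-rec t = trans (cong₂ (λ u v → α * u + β * v) (X-rec t) (Y-rec t))
    (solve 8 (λ α β A c x₁ x₀ y₁ y₀ → α :* (A :* x₁ :+ c :* x₀) :+ β :* (A :* y₁ :+ c :* y₀)
                := A :* (α :* x₁ :+ β :* y₁) :+ c :* (α :* x₀ :+ β :* y₀)) refl
      α β A c (X (ℤ.suc t)) (X t) (Y (ℤ.suc t)) (Y t))

  recurrent-scale : ∀ {X} α → Recurrent X → Recurrent (λ t → α * X t)
  recurrent-scale {X} α X-rec t = trans (cong (α *_) (X-rec t))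
    (solve 5 (λ α A c x₁ x₀ → α :* (A :* x₁ :+ c :* x₀) := A :* (α :* x₁) :+ c :* (α :* x₀)) refl α A c (X (ℤ.suc t)) (X t))

  backward-step : ∀ u w → u ≡ A * w + c * (- (A * c ⁻¹) * w + c ⁻¹ * u)
  backward-step u w = sym (begin
    A * w + c * (- (A * c ⁻¹) * w + c ⁻¹ * u)
      ≡⟨ solve 5 (λ A w c c′ u → A :* w :+ c :* (:- (A :* c′) :* w :+ c′ :* u)
                                  := A :* w :+ :- (A :* w) :* (c :* c′) :+ (c :* c′) :* u) refl A w c (c ⁻¹) u ⟩
    A * w + - (A * w) * (c * c ⁻¹) + (c * c ⁻¹) * u
      ≡⟨ cong (λ t → A * w + - (A * w) * t + t * u) (inverseʳ c c≢0) ⟩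
    A * w + - (A * w) * 1# + 1# * u
      ≡⟨ solve 2 (λ v u → v :+ :- v :* 𝟙 :+ 𝟙 :* u := u) refl (A * w) u ⟩
    u ∎)

  𝒫-recurrent : ∀ p q r → Recurrent (𝒫 ℝ x p q r a b c)
  𝒫-recurrent p q r (ℤ.+ n) = refl
  𝒫-recurrent p q r -[1+ zero ] = backward-step (q * x + r) p
  𝒫-recurrent p q r -[1+ suc zero ] = backward-step p (P -[1+ 0 ])
    where P = 𝒫 ℝ x p q r a b c
  𝒫-recurrent p q r -[1+ suc (suc n) ] = backward-step (P -[1+ n ]) (P -[1+ suc n ])
    where P = 𝒫 ℝ x p q r a b c

  U : ℤ → Carrier
  U = 𝒫 ℝ x 0# 0# 1# a b c

  c*U₋₁≡1 : c * U -[1+ 0 ] ≡ 1#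
  c*U₋₁≡1 = begin
    c * (- (A * c ⁻¹) * 0# + c ⁻¹ * (0# * x + 1#))
      ≡⟨ solve 4 (λ c c′ A x → c :* (:- (A :* c′) :* 𝟘 :+ c′ :* (𝟘 :* x :+ 𝟙)) := c :* c′) refl c (c ⁻¹) A x ⟩
    c * c ⁻¹
      ≡⟨ inverseʳ c c≢0 ⟩
    1# ∎

  module Solution (p q r : Carrier) where
    P : ℤ → Carrier
    P = 𝒫 ℝ x p q r a b c

    P-recurrent : Recurrent P
    P-recurrent = 𝒫-recurrent p q r

    Δ : Carrier
    Δ = P (ℤ.+ 1) * P (ℤ.+ 1) - A * P (ℤ.+ 0) * P (ℤ.+ 1) - c * P (ℤ.+ 0) * P (ℤ.+ 0)

    cassini : ∀ t → P (ℤ.suc (ℤ.suc t)) * P t - P (ℤ.suc t) * P (ℤ.suc t) ≡ (- c) ^ℤ t * - Δ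
    cassini t = trans (geometric K (- c) (-‿nonZero c≢0) K-step t) (cong ((- c) ^ℤ t *_) K₀)
      where
      K : ℤ → Carrier
      K t = P (ℤ.suc (ℤ.suc t)) * P t - P (ℤ.suc t) * P (ℤ.suc t)
      K-step : ∀ t → K (ℤ.suc t) ≡ (- c) * K t
      K-step t = begin
        P (ℤ.suc (ℤ.suc (ℤ.suc t))) * P (ℤ.suc t) - P (ℤ.suc (ℤ.suc t)) * P (ℤ.suc (ℤ.suc t))
          ≡⟨ cong₂ (λ u v → u * P (ℤ.suc t) - v * v)
               (trans (P-recurrent (ℤ.suc t)) (cong (λ u → A * u + c * P (ℤ.suc t)) (P-recurrent t))) (P-recurrent t) ⟩
        (A * (A * P (ℤ.suc t) + c * P t) + c * P (ℤ.suc t)) * P (ℤ.suc t) - (A * P (ℤ.suc t) + c * P t) * (A * P (ℤ.suc t) + c * P t)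
          ≡⟨ solve 4 (λ A c p₁ p₀ → (A :* (A :* p₁ :+ c :* p₀) :+ c :* p₁) :* p₁ :- (A :* p₁ :+ c :* p₀) :* (A :* p₁ :+ c :* p₀)
                 := (:- c) :* ((A :* p₁ :+ c :* p₀) :* p₀ :- p₁ :* p₁)) refl A c (P (ℤ.suc t)) (P t) ⟩
        (- c) * ((A * P (ℤ.suc t) + c * P t) * P t - P (ℤ.suc t) * P (ℤ.suc t))
          ≡⟨ cong (λ u → (- c) * (u * P t - P (ℤ.suc t) * P (ℤ.suc t))) (sym (P-recurrent t)) ⟩
        (- c) * K t ∎
      K₀ : K (ℤ.+ 0) ≡ - Δ
      K₀ = trans (cong (λ u → u * P (ℤ.+ 0) - P (ℤ.+ 1) * P (ℤ.+ 1)) (P-recurrent (ℤ.+ 0)))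
        (solve 4 (λ A c p₁ p₀ → (A :* p₁ :+ c :* p₀) :* p₀ :- p₁ :* p₁ := :- (p₁ :* p₁ :- A :* p₀ :* p₁ :- c :* p₀ :* p₀)) refl
          A c (P (ℤ.+ 1)) (P (ℤ.+ 0)))

    -- Both sides solve the recurrence in w, so it suffices to check w = 0 and w = 1.
    addition : ∀ t w → P (t ℤ.+ w) ≡ P (ℤ.suc t) * U w + (c * P t) * U (-[1+ 0 ] ℤ.+ w)
    addition t = recurrent-unique (λ w → P (t ℤ.+ w)) (λ w → P (ℤ.suc t) * U w + (c * P t) * U (-[1+ 0 ] ℤ.+ w))
      (recurrent-shift P-recurrent t)
      (recurrent-lincomb (P (ℤ.suc t)) (c * P t) (𝒫-recurrent 0# 0# 1#) (recurrent-shift (𝒫-recurrent 0# 0# 1#) -[1+ 0 ]))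
      (begin
        P (t ℤ.+ ℤ.+ 0)                                 ≡⟨ cong P (ℤP.+-identityʳ t) ⟩
        P t                                             ≡⟨ sym (*-identityʳ _) ⟩
        P t * 1#                                        ≡⟨ cong (P t *_) (sym c*U₋₁≡1) ⟩
        P t * (c * U -[1+ 0 ])                          ≡⟨ solve 4 (λ a c b u → b :* (c :* u) := a :* 𝟘 :+ (c :* b) :* u) refl
                                                             (P (ℤ.suc t)) c (P t) (U -[1+ 0 ]) ⟩
        P (ℤ.suc t) * 0# + (c * P t) * U -[1+ 0 ]       ∎)
      (trans (cong P (ℤP.+-comm t (ℤ.+ 1)))
        (solve 3 (λ a b x → a := a :* (𝟘 :* x :+ 𝟙) :+ b :* 𝟘) refl (P (ℤ.suc t)) (c * P t) x))

    dOcagne : ∀ t w → P t * P (t ℤ.+ ℤ.suc w) + (- P (ℤ.suc t)) * P (t ℤ.+ w) ≡ ((- c) ^ℤ t * - Δ) * U w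
    dOcagne t = recurrent-unique (λ w → P t * P (t ℤ.+ ℤ.suc w) + (- P (ℤ.suc t)) * P (t ℤ.+ w)) (λ w → ((- c) ^ℤ t * - Δ) * U w)
      (recurrent-lincomb (P t) (- P (ℤ.suc t))
        (recurrent-cong (recurrent-shift P-recurrent (ℤ.suc t)) (λ w → cong P (suc-+ t w)))
        (recurrent-shift P-recurrent t))
      (recurrent-scale ((- c) ^ℤ t * - Δ) (𝒫-recurrent 0# 0# 1#))
      (trans (cong₂ (λ u v → P t * P u + (- P (ℤ.suc t)) * P v) (ℤP.+-comm t (ℤ.+ 1)) (ℤP.+-identityʳ t))
        (solve 3 (λ a b k → a :* b :+ (:- b) :* a := k :* 𝟘) refl (P t) (P (ℤ.suc t)) ((- c) ^ℤ t * - Δ)))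
      (begin
        P t * P (t ℤ.+ ℤ.+ 2) + (- P (ℤ.suc t)) * P (t ℤ.+ ℤ.+ 1)
          ≡⟨ cong₂ (λ u v → P t * P u + (- P (ℤ.suc t)) * P v)
               (trans (ℤ+-suc t (ℤ.+ 1)) (cong ℤ.suc (ℤP.+-comm t (ℤ.+ 1)))) (ℤP.+-comm t (ℤ.+ 1)) ⟩
        P t * P (ℤ.suc (ℤ.suc t)) + (- P (ℤ.suc t)) * P (ℤ.suc t)
          ≡⟨ solve 3 (λ a b d → a :* b :+ (:- d) :* d := b :* a :- d :* d) refl (P t) (P (ℤ.suc (ℤ.suc t))) (P (ℤ.suc t)) ⟩
        P (ℤ.suc (ℤ.suc t)) * P t - P (ℤ.suc t) * P (ℤ.suc t)
          ≡⟨ cassini t ⟩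
        (- c) ^ℤ t * - Δ
          ≡⟨ solve 2 (λ k x → k := k :* (𝟘 :* x :+ 𝟙)) refl ((- c) ^ℤ t * - Δ) x ⟩
        ((- c) ^ℤ t * - Δ) * U (ℤ.+ 1) ∎)
      where
      suc-+ : ∀ t w → ℤ.suc t ℤ.+ w ≡ t ℤ.+ ℤ.suc w
      suc-+ t w = trans (ℤP.+-assoc (ℤ.+ 1) t w) (sym (ℤ+-suc t w))


module ReciprocalHankel (ℝ : RealField) (x p q r a b c : RealField.Carrier ℝ) (c≢0 : ¬ (c ≡ RealField.0# ℝ)) (k : ℤ) where
  open FieldProperties ℝ
  open BigOperators ℝ
  open Determinant ℝ using (Det; det-cong)
  open InverseRankTwoDeterminant ℝ
  open IntegerPowers ℝ
  open LinearRecurrence ℝ x a b c c≢0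
  open Solution p q r
  module U = Solution 0# 0# 1#
  open ≡-Reasoning

  _+k*_ : ℤ → ℕ → ℤ
  u +k* i = u ℤ.+ k ℤ.* ℤ.+ i

  +k*-zero : ∀ u → u +k* 0 ≡ u
  +k*-zero u = solveℤ 2 (λ u k → u :+ᶻ k :*ᶻ conᶻ (ℤ.+ 0) :=ᶻ u) refl u k

  +k*-suc : ∀ u i → u +k* suc i ≡ (u ℤ.+ k) +k* i
  +k*-suc u i = solveℤ 3 (λ u k i → u :+ᶻ k :*ᶻ (conᶻ (ℤ.+ 1) :+ᶻ i) :=ᶻ (u :+ᶻ k) :+ᶻ k :*ᶻ i) refl u k (ℤ.+ i)

  -- The addition formula splits P ((u +k* i) + (v +k* j)) as rank₂ (rowA u) (rowB u) (colG v) (colH v) i j.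
  rowA rowB colG colH : ℤ → ∀ {n} → Fin n → Carrier
  rowA u i = P (ℤ.suc (u +k* toℕ i))
  rowB u i = c * P (u +k* toℕ i)
  colG v j = U (v +k* toℕ j)
  colH v j = U (-[1+ 0 ] ℤ.+ (v +k* toℕ j))

  suc[-1+v]≡v : ∀ v → ℤ.suc (-[1+ 0 ] ℤ.+ v) ≡ v
  suc[-1+v]≡v = solveℤ 1 (λ v → conᶻ (ℤ.+ 1) :+ᶻ (conᶻ -[1+ 0 ] :+ᶻ v) :=ᶻ v) refl

  Uₖ : ∀ {n} → Fin n → Carrier
  Uₖ i = U (k ℤ.* ℤ.+ suc (toℕ i))

  U-Δ≡1 : U.Δ ≡ 1#
  U-Δ≡1 = solve 3 (λ x A c → (𝟘 :* x :+ 𝟙) :* (𝟘 :* x :+ 𝟙)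
                              :- A :* 𝟘 :* (𝟘 :* x :+ 𝟙) :- c :* 𝟘 :* 𝟘
                              := 𝟙) refl x A c

  row-cross : ∀ u {n} (i : Fin n) → rowA u {suc n} (suc i) * rowB u {suc n} zero - rowA u {suc n} zero * rowB u {suc n} (suc i)
                                      ≡ c * (((- c) ^ℤ u * - Δ) * Uₖ i)
  row-cross u i = begin
    P (ℤ.suc (u ℤ.+ w)) * (c * P (u +k* 0)) - P (ℤ.suc (u +k* 0)) * (c * P (u ℤ.+ w))
      ≡⟨ cong₂ (λ s t → P s * (c * P t) - P (ℤ.suc t) * (c * P (u ℤ.+ w))) (sym (ℤ+-suc u w)) (+k*-zero u) ⟩
    P (u ℤ.+ ℤ.suc w) * (c * P u) - P (ℤ.suc u) * (c * P (u ℤ.+ w))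
      ≡⟨ solve 5 (λ a c b d e → a :* (c :* b) :- d :* (c :* e) := c :* (b :* a :+ (:- d) :* e)) refl
           (P (u ℤ.+ ℤ.suc w)) c (P u) (P (ℤ.suc u)) (P (u ℤ.+ w)) ⟩
    c * (P u * P (u ℤ.+ ℤ.suc w) + (- P (ℤ.suc u)) * P (u ℤ.+ w))
      ≡⟨ cong (c *_) (dOcagne u w) ⟩
    c * (((- c) ^ℤ u * - Δ) * U w) ∎
    where w = k ℤ.* ℤ.+ suc (toℕ i)

  col-cross : ∀ v {n} (j : Fin n) → colH v {suc n} (suc j) * colG v {suc n} zero - colH v {suc n} zero * colG v {suc n} (suc j)
                                      ≡ (- c) ^ℤ (-[1+ 0 ] ℤ.+ v) * Uₖ j
  col-cross v j = begin
    U (-[1+ 0 ] ℤ.+ (v ℤ.+ w)) * U (v +k* 0) - U (-[1+ 0 ] ℤ.+ (v +k* 0)) * U (v ℤ.+ w)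
      ≡⟨ cong (λ s → U (-[1+ 0 ] ℤ.+ (v ℤ.+ w)) * U s - U (-[1+ 0 ] ℤ.+ s) * U (v ℤ.+ w)) (+k*-zero v) ⟩
    U (-[1+ 0 ] ℤ.+ (v ℤ.+ w)) * U v - U t * U (v ℤ.+ w)
      ≡⟨ cong₂ (λ s₁ s₂ → U s₁ * U s₂ - U t * U (v ℤ.+ w)) (sym (ℤP.+-assoc -[1+ 0 ] v w)) (sym (suc[-1+v]≡v v)) ⟩
    U (t ℤ.+ w) * U (ℤ.suc t) - U t * U (v ℤ.+ w)
      ≡⟨ cong (λ s → U (t ℤ.+ w) * U (ℤ.suc t) - U t * U s) (sym t+suc-w) ⟩
    U (t ℤ.+ w) * U (ℤ.suc t) - U t * U (t ℤ.+ ℤ.suc w)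
      ≡⟨ solve 4 (λ a b c d → a :* b :- c :* d := :- (c :* d :+ (:- b) :* a)) refl (U (t ℤ.+ w)) (U (ℤ.suc t)) (U t) (U (t ℤ.+ ℤ.suc w)) ⟩
    - (U t * U (t ℤ.+ ℤ.suc w) + (- U (ℤ.suc t)) * U (t ℤ.+ w))
      ≡⟨ cong -_ (U.dOcagne t w) ⟩
    - (((- c) ^ℤ t * - U.Δ) * U w)
      ≡⟨ cong (λ d → - (((- c) ^ℤ t * - d) * U w)) U-Δ≡1 ⟩
    - (((- c) ^ℤ t * - 1#) * U w)
      ≡⟨ solve 2 (λ z u → :- ((z :* :- 𝟙) :* u) := z :* u) refl ((- c) ^ℤ t) (U w) ⟩
    (- c) ^ℤ t * U w ∎
    where
    w = k ℤ.* ℤ.+ suc (toℕ j)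
    t = -[1+ 0 ] ℤ.+ v
    t+suc-w : t ℤ.+ ℤ.suc w ≡ v ℤ.+ w
    t+suc-w = solveℤ 2 (λ v w → (conᶻ -[1+ 0 ] :+ᶻ v) :+ᶻ (conᶻ (ℤ.+ 1) :+ᶻ w) :=ᶻ v :+ᶻ w) refl v w

  cross-pair : ∀ u v {n} (i : Fin n) →
    (rowA u {suc n} (suc i) * rowB u {suc n} zero - rowA u {suc n} zero * rowB u {suc n} (suc i)) *
    (colH v {suc n} (suc i) * colG v {suc n} zero - colH v {suc n} zero * colG v {suc n} (suc i))
      ≡ (- c) ^ℤ (u ℤ.+ v) * Δ * (Uₖ i * Uₖ i)
  cross-pair u v i = begin
    _ ≡⟨ cong₂ _*_ (row-cross u i) (col-cross v i) ⟩
    c * (((- c) ^ℤ u * - Δ) * Uₖ i) * ((- c) ^ℤ t * Uₖ i)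
      ≡⟨ solve 5 (λ c y d u z → c :* ((y :* :- d) :* u) :* (z :* u) := ((:- c) :* z) :* y :* d :* (u :* u)) refl
           c ((- c) ^ℤ u) Δ (Uₖ i) ((- c) ^ℤ t) ⟩
    ((- c) * (- c) ^ℤ t) * (- c) ^ℤ u * Δ * (Uₖ i * Uₖ i)
      ≡⟨ cong (λ y → y * (- c) ^ℤ u * Δ * (Uₖ i * Uₖ i))
           (sym (trans (cong ((- c) ^ℤ_) (sym (suc[-1+v]≡v v))) (^ℤ-suc (-‿nonZero c≢0) t))) ⟩
    (- c) ^ℤ v * (- c) ^ℤ u * Δ * (Uₖ i * Uₖ i)
      ≡⟨ cong (λ y → y * Δ * (Uₖ i * Uₖ i)) (trans (*-comm _ _) (sym (^ℤ-+ (-‿nonZero c≢0) u v))) ⟩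
    (- c) ^ℤ (u ℤ.+ v) * Δ * (Uₖ i * Uₖ i) ∎
    where
    t = -[1+ 0 ] ℤ.+ v

  crossProducts : ℕ → ℤ → ℤ → Carrier
  crossProducts n u v = crossProduct n (rowA u) (rowB u) * crossProduct n (colH v) (colG v)

  crossProducts-suc : ∀ n u v →
    crossProducts (suc n) u v ≡ ∏ n (λ i → (- c) ^ℤ (u ℤ.+ v) * Δ * (Uₖ i * Uₖ i)) * crossProducts n (u ℤ.+ k) (v ℤ.+ k)
  crossProducts-suc n u v = begin
    (∏ n row₀ * crossProduct n (rowA u ∘ suc) (rowB u ∘ suc)) * (∏ n col₀ * crossProduct n (colH v ∘ suc) (colG v ∘ suc))
      ≡⟨ solve 4 (λ a b c d → (a :* b) :* (c :* d) := (a :* c) :* (b :* d)) refl _ _ _ _ ⟩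
    (∏ n row₀ * ∏ n col₀) * (crossProduct n (rowA u ∘ suc) (rowB u ∘ suc) * crossProduct n (colH v ∘ suc) (colG v ∘ suc))
      ≡⟨ cong₂ _*_ (trans (sym (∏-* n row₀ col₀)) (∏-cong n (cross-pair u v)))
           (cong₂ _*_ (crossProduct-cong n (λ i → cong (P ∘ ℤ.suc) (+k*-suc u (toℕ i))) (λ i → cong (λ s → c * P s) (+k*-suc u (toℕ i))))
                      (crossProduct-cong n (λ i → cong (λ s → U (-[1+ 0 ] ℤ.+ s)) (+k*-suc v (toℕ i))) (λ i → cong U (+k*-suc v (toℕ i))))) ⟩
    ∏ n (λ i → (- c) ^ℤ (u ℤ.+ v) * Δ * (Uₖ i * Uₖ i)) * crossProducts n (u ℤ.+ k) (v ℤ.+ k) ∎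
    where
    row₀ col₀ : Fin n → Carrier
    row₀ i = rowA u {suc n} (suc i) * rowB u {suc n} zero - rowA u {suc n} zero * rowB u {suc n} (suc i)
    col₀ i = colH v {suc n} (suc i) * colG v {suc n} zero - colH v {suc n} zero * colG v {suc n} (suc i)

  exponent : ℕ → ℤ → ℤ → ℤ
  exponent m u v = ℤ.+ (suc m C 2) ℤ.* (u ℤ.+ v) ℤ.+ ℤ.+ 2 ℤ.* k ℤ.* ℤ.+ (suc m C 3)

  exponent-suc : ∀ m u v → ℤ.+ (suc m) ℤ.* (u ℤ.+ v) ℤ.+ exponent m (u ℤ.+ k) (v ℤ.+ k) ≡ exponent (suc m) u v
  exponent-suc m u v = begin
    ℤ.+ N ℤ.* (u ℤ.+ v) ℤ.+ (ℤ.+ C₂ ℤ.* ((u ℤ.+ k) ℤ.+ (v ℤ.+ k)) ℤ.+ ℤ.+ 2 ℤ.* k ℤ.* ℤ.+ C₃)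
      ≡⟨ solveℤ 6 (λ n c₂ c₃ u v k → n :*ᶻ (u :+ᶻ v) :+ᶻ (c₂ :*ᶻ ((u :+ᶻ k) :+ᶻ (v :+ᶻ k)) :+ᶻ conᶻ (ℤ.+ 2) :*ᶻ k :*ᶻ c₃)
           :=ᶻ (n :+ᶻ c₂) :*ᶻ (u :+ᶻ v) :+ᶻ conᶻ (ℤ.+ 2) :*ᶻ k :*ᶻ (c₂ :+ᶻ c₃)) refl (ℤ.+ N) (ℤ.+ C₂) (ℤ.+ C₃) u v k ⟩
    (ℤ.+ N ℤ.+ ℤ.+ C₂) ℤ.* (u ℤ.+ v) ℤ.+ ℤ.+ 2 ℤ.* k ℤ.* (ℤ.+ C₂ ℤ.+ ℤ.+ C₃)
      ≡⟨ cong₂ (λ s t → ℤ.+ s ℤ.* (u ℤ.+ v) ℤ.+ ℤ.+ 2 ℤ.* k ℤ.* ℤ.+ t) (n+nC2≡[1+n]C2 N) (nCk+nC[k+1]≡[n+1]C[k+1] N 2) ⟩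
    exponent (suc m) u v ∎
    where
    N = suc m
    C₂ = suc m C 2
    C₃ = suc m C 3

  U-powers-suc : ∀ m → ∏ (suc m) (λ i → Uₖ i * Uₖ i) * ∏ (suc m) (λ i → Uₖ i ^ℕ (2 ℕ.* (m ∸ toℕ i)))
                        ≡ ∏ (suc (suc m)) (λ i → Uₖ i ^ℕ (2 ℕ.* (suc m ∸ toℕ i)))
  U-powers-suc m = sym (begin
    ∏ (suc N) (λ i → Uₖ i ^ℕ (2 ℕ.* (N ∸ toℕ i)))
      ≡⟨ ∏-last N (λ i → Uₖ i ^ℕ (2 ℕ.* (N ∸ toℕ i))) ⟩
    ∏ N (λ i → Uₖ (F.inject₁ i) ^ℕ (2 ℕ.* (N ∸ toℕ (F.inject₁ i)))) * Uₖ (F.fromℕ N) ^ℕ (2 ℕ.* (N ∸ toℕ (F.fromℕ N)))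
      ≡⟨ cong₂ _*_ (∏-cong N split-square)
           (cong (λ e → Uₖ (F.fromℕ N) ^ℕ (2 ℕ.* e)) (trans (cong (N ∸_) (FP.toℕ-fromℕ N)) (ℕP.n∸n≡0 N))) ⟩
    ∏ N (λ i → (Uₖ i * Uₖ i) * Uₖ i ^ℕ (2 ℕ.* (m ∸ toℕ i))) * 1#
      ≡⟨ trans (*-identityʳ _) (∏-* N (λ i → Uₖ i * Uₖ i) (λ i → Uₖ i ^ℕ (2 ℕ.* (m ∸ toℕ i)))) ⟩
    ∏ N (λ i → Uₖ i * Uₖ i) * ∏ N (λ i → Uₖ i ^ℕ (2 ℕ.* (m ∸ toℕ i))) ∎)
    where
    N = suc m
    exponent-inject : ∀ (i : Fin N) → 2 ℕ.* (N ∸ toℕ (F.inject₁ i)) ≡ 2 ℕ.+ 2 ℕ.* (m ∸ toℕ i)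
    exponent-inject i = trans (cong (λ e → 2 ℕ.* (N ∸ e)) (FP.toℕ-inject₁ i))
      (trans (cong (2 ℕ.*_) (ℕP.+-∸-assoc 1 (FP.toℕ≤pred[n] i))) (ℕP.*-suc 2 (m ∸ toℕ i)))
    split-square : ∀ (i : Fin N) →
      Uₖ (F.inject₁ i) ^ℕ (2 ℕ.* (N ∸ toℕ (F.inject₁ i))) ≡ (Uₖ i * Uₖ i) * Uₖ i ^ℕ (2 ℕ.* (m ∸ toℕ i))
    split-square i = begin
      Uₖ (F.inject₁ i) ^ℕ (2 ℕ.* (N ∸ toℕ (F.inject₁ i)))
        ≡⟨ cong₂ (λ a e → U (k ℤ.* ℤ.+ suc a) ^ℕ e) (FP.toℕ-inject₁ i) (exponent-inject i) ⟩
      Uₖ i ^ℕ (2 ℕ.+ 2 ℕ.* (m ∸ toℕ i))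
        ≡⟨ ^ℕ-+ (Uₖ i) 2 (2 ℕ.* (m ∸ toℕ i)) ⟩
      (Uₖ i * (Uₖ i * 1#)) * Uₖ i ^ℕ (2 ℕ.* (m ∸ toℕ i))
        ≡⟨ cong (λ y → (Uₖ i * y) * Uₖ i ^ℕ (2 ℕ.* (m ∸ toℕ i))) (*-identityʳ (Uₖ i)) ⟩
      (Uₖ i * Uₖ i) * Uₖ i ^ℕ (2 ℕ.* (m ∸ toℕ i)) ∎

  crossProducts-closed : ∀ m u v →
    crossProducts (suc m) u v ≡ (- c) ^ℤ exponent m u v * (Δ ^ℕ (suc m C 2) * ∏ (suc m) (λ i → Uₖ i ^ℕ (2 ℕ.* (m ∸ toℕ i))))
  crossProducts-closed zero u v = begin
    1# * 1# * (1# * 1#)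
      ≡⟨ solve 0 (𝟙 :* 𝟙 :* (𝟙 :* 𝟙) := 𝟙 :* (𝟙 :* (𝟙 :* 𝟙))) refl ⟩
    1# * (1# * (1# * 1#))
      ≡⟨ cong (λ e → (- c) ^ℤ e * (1# * (1# * 1#))) (sym exponent≡0) ⟩
    (- c) ^ℤ exponent zero u v * (Δ ^ℕ 0 * ∏ 1 (λ i → Uₖ i ^ℕ 0)) ∎
    where
    exponent≡0 : exponent zero u v ≡ ℤ.+ 0
    exponent≡0 = solveℤ 3 (λ u v k → conᶻ (ℤ.+ 0) :*ᶻ (u :+ᶻ v) :+ᶻ conᶻ (ℤ.+ 2) :*ᶻ k :*ᶻ conᶻ (ℤ.+ 0) :=ᶻ conᶻ (ℤ.+ 0)) refl u v k
  crossProducts-closed (suc m) u v = begin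
    crossProducts (suc N) u v
      ≡⟨ crossProducts-suc N u v ⟩
    ∏ N (λ i → z * Δ * (Uₖ i * Uₖ i)) * crossProducts N (u ℤ.+ k) (v ℤ.+ k)
      ≡⟨ cong₂ _*_ first-row (crossProducts-closed m (u ℤ.+ k) (v ℤ.+ k)) ⟩
    ((z ^ℕ N * Δ ^ℕ N) * ∏ N UU) * ((- c) ^ℤ e′ * (Δ ^ℕ C₂ * ∏ N Uᵉ))
      ≡⟨ solve 6 (λ zᴺ Δᴺ pu ce Δᶜ pe → (zᴺ :* Δᴺ) :* pu :* (ce :* (Δᶜ :* pe)) := (zᴺ :* ce) :* ((Δᴺ :* Δᶜ) :* (pu :* pe)))
           refl (z ^ℕ N) (Δ ^ℕ N) (∏ N UU) ((- c) ^ℤ e′) (Δ ^ℕ C₂) (∏ N Uᵉ) ⟩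
    (z ^ℕ N * (- c) ^ℤ e′) * ((Δ ^ℕ N * Δ ^ℕ C₂) * (∏ N UU * ∏ N Uᵉ))
      ≡⟨ cong₂ _*_ sign-part (cong₂ _*_ Δ-part (U-powers-suc m)) ⟩
    (- c) ^ℤ exponent (suc m) u v * (Δ ^ℕ (suc N C 2) * ∏ (suc N) (λ i → Uₖ i ^ℕ (2 ℕ.* (N ∸ toℕ i)))) ∎
    where
    N = suc m
    z = (- c) ^ℤ (u ℤ.+ v)
    e′ = exponent m (u ℤ.+ k) (v ℤ.+ k)
    C₂ = suc m C 2
    UU Uᵉ : Fin N → Carrier
    UU i = Uₖ i * Uₖ i
    Uᵉ i = Uₖ i ^ℕ (2 ℕ.* (m ∸ toℕ i))
    first-row : ∏ N (λ i → z * Δ * UU i) ≡ (z ^ℕ N * Δ ^ℕ N) * ∏ N UU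
    first-row = trans (∏-* N (λ _ → z * Δ) UU)
      (cong (_* ∏ N UU) (trans (∏-* N (λ _ → z) (λ _ → Δ)) (cong₂ _*_ (∏-const N z) (∏-const N Δ))))
    sign-part : z ^ℕ N * (- c) ^ℤ e′ ≡ (- c) ^ℤ exponent (suc m) u v
    sign-part = begin
      z ^ℕ N * (- c) ^ℤ e′                           ≡⟨ cong (_* (- c) ^ℤ e′) (^ℤ-^ℕ (-‿nonZero c≢0) (u ℤ.+ v) N) ⟩
      (- c) ^ℤ (ℤ.+ N ℤ.* (u ℤ.+ v)) * (- c) ^ℤ e′    ≡⟨ sym (^ℤ-+ (-‿nonZero c≢0) (ℤ.+ N ℤ.* (u ℤ.+ v)) e′) ⟩
      (- c) ^ℤ (ℤ.+ N ℤ.* (u ℤ.+ v) ℤ.+ e′)          ≡⟨ cong ((- c) ^ℤ_) (exponent-suc m u v) ⟩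
      (- c) ^ℤ exponent (suc m) u v                  ∎
    Δ-part : Δ ^ℕ N * Δ ^ℕ C₂ ≡ Δ ^ℕ (suc N C 2)
    Δ-part = trans (sym (^ℕ-+ Δ N C₂)) (cong (Δ ^ℕ_) (n+nC2≡[1+n]C2 N))

  Δ-explicit : Δ ≡ (q * q - a * p * q) * (x * x) + (q * r + q * r - a * p * r - b * p * q) * x + (r * r - b * p * r - c * p * p)
  Δ-explicit = solve 7 (λ p q r a b c x → (q :* x :+ r) :* (q :* x :+ r) :- (a :* x :+ b) :* p :* (q :* x :+ r) :- c :* p :* p
    := (q :* q :- a :* p :* q) :* (x :* x) :+ (q :* r :+ q :* r :- a :* p :* r :- b :* p :* q) :* x :+ (r :* r :- b :* p :* r :- c :* p :* p))
    refl p q r a b c x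

  det-reciprocal : ∀ s n m → let idx = λ (i j : Fin (suc m)) → s ℤ.+ k ℤ.* (n ℤ.+ ℤ.+ toℕ i ℤ.+ ℤ.+ toℕ j) in
    (∀ i j → NonZero (P (idx i j))) →
    Det (suc m) (λ i j → P (idx i j) ⁻¹) * ∏ (suc m) (λ i → ∏ (suc m) (λ j → P (idx i j)))
      ≡ (- 1#) ^ℤ ((s ℤ.+ k ℤ.* n) ℤ.* ℤ.+ (suc m C 2)) * c ^ℤ ((s ℤ.+ k ℤ.* n) ℤ.* ℤ.+ (suc m C 2) ℤ.+ ℤ.+ 2 ℤ.* k ℤ.* ℤ.+ (suc m C 3))
        * Δ ^ℕ (suc m C 2) * ∏ (suc m) (λ i → Uₖ i ^ℕ (2 ℕ.* (m ∸ toℕ i)))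
  det-reciprocal s n m P≢0 = begin
    Det (suc m) (λ i j → P (idx i j) ⁻¹) * ∏ (suc m) (λ i → ∏ (suc m) (λ j → P (idx i j)))
      ≡⟨ cong₂ _*_ (det-cong (suc m) (λ i j → cong _⁻¹ (entry i j))) (∏-cong (suc m) (λ i → ∏-cong (suc m) (entry i))) ⟩
    Det (suc m) (λ i j → E i j ⁻¹) * ∏ (suc m) (λ i → ∏ (suc m) (E i))
      ≡⟨ det-⁻¹-rank₂ m (rowA u) (rowB u) (colG (ℤ.+ 0)) (colH (ℤ.+ 0)) (λ i j → P≢0 i j ∘ trans (entry i j)) ⟩
    crossProducts (suc m) u (ℤ.+ 0)
      ≡⟨ crossProducts-closed m u (ℤ.+ 0) ⟩
    (- c) ^ℤ exponent m u (ℤ.+ 0) * (Δ ^ℕ C₂ * ΠU)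
      ≡⟨ cong (λ e → (- c) ^ℤ e * (Δ ^ℕ C₂ * ΠU)) exponent≡ ⟩
    (- c) ^ℤ (e₁ ℤ.+ ℤ.+ 2 ℤ.* (k ℤ.* ℤ.+ C₃)) * (Δ ^ℕ C₂ * ΠU)
      ≡⟨ cong (_* (Δ ^ℕ C₂ * ΠU)) ([-x]^ℤ c≢0 e₁ (k ℤ.* ℤ.+ C₃)) ⟩
    ((- 1#) ^ℤ e₁ * c ^ℤ (e₁ ℤ.+ ℤ.+ 2 ℤ.* (k ℤ.* ℤ.+ C₃))) * (Δ ^ℕ C₂ * ΠU)
      ≡⟨ cong (λ e → ((- 1#) ^ℤ e₁ * c ^ℤ (e₁ ℤ.+ e)) * (Δ ^ℕ C₂ * ΠU)) (sym (ℤP.*-assoc (ℤ.+ 2) k (ℤ.+ C₃))) ⟩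
    ((- 1#) ^ℤ e₁ * c ^ℤ (e₁ ℤ.+ ℤ.+ 2 ℤ.* k ℤ.* ℤ.+ C₃)) * (Δ ^ℕ C₂ * ΠU)
      ≡⟨ sym (*-assoc _ _ _) ⟩
    (- 1#) ^ℤ e₁ * c ^ℤ (e₁ ℤ.+ ℤ.+ 2 ℤ.* k ℤ.* ℤ.+ C₃) * Δ ^ℕ C₂ * ΠU ∎
    where
    idx : Fin (suc m) → Fin (suc m) → ℤ
    idx i j = s ℤ.+ k ℤ.* (n ℤ.+ ℤ.+ toℕ i ℤ.+ ℤ.+ toℕ j)
    u = s ℤ.+ k ℤ.* n
    C₂ = suc m C 2
    C₃ = suc m C 3
    e₁ = u ℤ.* ℤ.+ C₂
    ΠU = ∏ (suc m) (λ i → Uₖ i ^ℕ (2 ℕ.* (m ∸ toℕ i)))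
    E = rank₂ (rowA u) (rowB u) (colG (ℤ.+ 0)) (colH (ℤ.+ 0))
    entry : ∀ i j → P (idx i j) ≡ E i j
    entry i j = trans (cong P (solveℤ 5 (λ s k n i j → s :+ᶻ k :*ᶻ (n :+ᶻ i :+ᶻ j) :=ᶻ ((s :+ᶻ k :*ᶻ n) :+ᶻ k :*ᶻ i) :+ᶻ (conᶻ (ℤ.+ 0) :+ᶻ k :*ᶻ j))
                                  refl s k n (ℤ.+ toℕ i) (ℤ.+ toℕ j)))
                      (addition (u +k* toℕ i) ((ℤ.+ 0) +k* toℕ j))
    exponent≡ : exponent m u (ℤ.+ 0) ≡ e₁ ℤ.+ ℤ.+ 2 ℤ.* (k ℤ.* ℤ.+ C₃)
    exponent≡ = solveℤ 4 (λ u k c₂ c₃ → c₂ :*ᶻ (u :+ᶻ conᶻ (ℤ.+ 0)) :+ᶻ conᶻ (ℤ.+ 2) :*ᶻ k :*ᶻ c₃ :=ᶻ u :*ᶻ c₂ :+ᶻ conᶻ (ℤ.+ 2) :*ᶻ (k :*ᶻ c₃))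
                  refl u k (ℤ.+ C₂) (ℤ.+ C₃)


-- Imported only here: the prefix operator +_ would make sections like (x +_) ambiguous above.
open import Data.Integer using (+_)

theorem4 : (ℝ : RealField) → let open RealField ℝ in
    (s k n : ℤ) (m : ℕ) → 1 ℕ.≤ m →
    (p q r a b c x : Carrier) → ¬ (c ≡ 0#) →
    let P = 𝒫 ℝ x p q r a b c
        U = 𝒫 ℝ x 0# 0# 1# a b c
        Δ = (q * q - a * p * q) * (x * x) + (q * r + q * r - a * p * r - b * p * q) * x
              + (r * r - b * p * r - c * p * p)
        idx = λ (i j : Fin (suc m)) → s ℤ.+ k ℤ.* (n ℤ.+ + toℕ i ℤ.+ + toℕ j)
        e₁ = (s ℤ.+ k ℤ.* n) ℤ.* + (suc m C 2)
        e = e₁ ℤ.+ + 2 ℤ.* k ℤ.* + (suc m C 3)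
    in (∀ (i j : Fin (suc m)) → ¬ (P (idx i j) ≡ 0#)) →
       det ℝ (suc m) (λ i j → P (idx i j) ⁻¹)
         ≡ (_^ᶻ_ ℝ (- 1#) e₁ * _^ᶻ_ ℝ c e * _^_ ℝ Δ (suc m C 2)
             * Π' ℝ (suc m) (λ i → _^_ ℝ (U (k ℤ.* + (suc (toℕ i)))) (2 ℕ.* (m ∸ toℕ i))))
           * (Π' ℝ (suc m) (λ i → Π' ℝ (suc m) (λ j → P (idx i j)))) ⁻¹
theorem4 ℝ s k n m _ p q r a b c x c≢0 P≢0 = begin
    Det (suc m) M                           ≡⟨ sym (x*y*y⁻¹≡x (Det (suc m) M) ∏∏P≢0) ⟩
    Det (suc m) M * ∏∏P * ∏∏P ⁻¹            ≡⟨ cong (_* ∏∏P ⁻¹) (det-reciprocal s n m P≢0) ⟩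
    (sign * Δ ^ℕ (suc m C 2) * ΠU) * ∏∏P ⁻¹  ≡⟨ cong (λ d → (sign * d ^ℕ (suc m C 2) * ΠU) * ∏∏P ⁻¹) Δ-explicit ⟩
    _                                       ∎
  where
  open FieldProperties ℝ
  open BigOperators ℝ
  open Determinant ℝ using (Det)
  open IntegerPowers ℝ
  open LinearRecurrence.Solution ℝ x a b c c≢0 p q r using (P; Δ)
  open ReciprocalHankel ℝ x p q r a b c c≢0 k
  open ≡-Reasoning
  idx : Fin (suc m) → Fin (suc m) → ℤ
  idx i j = s ℤ.+ k ℤ.* (n ℤ.+ + toℕ i ℤ.+ + toℕ j)
  M = λ i j → P (idx i j) ⁻¹
  ∏∏P = ∏ (suc m) (λ i → ∏ (suc m) (λ j → P (idx i j)))
  ∏∏P≢0 = ∏-nonZero (suc m) _ (λ i → ∏-nonZero (suc m) _ (P≢0 i))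
  e₁ = (s ℤ.+ k ℤ.* n) ℤ.* + (suc m C 2)
  sign = (- 1#) ^ℤ e₁ * c ^ℤ (e₁ ℤ.+ + 2 ℤ.* k ℤ.* + (suc m C 3))
  ΠU = ∏ (suc m) (λ i → Uₖ i ^ℕ (2 ℕ.* (m ∸ toℕ i)))
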